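{- Let $q\in\mathbb{N}\cup\{\infty\}$. There exists a map $\tau:\mathrm{Form}_{\forall_1[\exists]}(\mathfrak{L}_{\mathrm{ring}})\to\mathrm{Form}_{\exists}(\mathfrak{L}_{\mathrm{ring}}(t))\times\mathrm{Form}_{\forall_1[\exists]}(\mathfrak{L}_{\mathrm{ring}})$ such that if $k$ is a field with $\#k=q$, $\varphi\in\mathrm{Form}_{\forall_1[\exists]}(\mathfrak{L}_{\mathrm{ring}})$ has $n$ free variables and $\tau\varphi=(\psi_1,\psi_2)$, then $\mathrm{Var}(\psi_1)=\mathrm{Var}(\psi_2)=\mathrm{Var}(\varphi)$ and $\varphi(k(t))\cap k^n=\psi_1((k(t),t))\cap\psi_2(k)$. In particular, for $\varphi\in\mathrm{Sent}_{\forall_1[\exists]}(\mathfrak{L}_{\mathrm{ring}})$, $k(t)\models\varphi$ if and only if $(k(t),t)\models\psi_1$ and $k\models\psi_2$. The map $\tau$ is computable, uniformly in $q$.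
   Context: $\mathrm{Form}_{\exists}(\mathfrak{L})$ is the set of existential $\mathfrak{L}$-formulas (smallest set containing quantifier-free formulas and $\top,\bot$, closed under $\wedge,\vee,\exists x$). $\mathrm{Form}_{\forall_1[\exists]}(\mathfrak{L})$ is the set of formulas that are either existential or of the form $\forall x\psi$ with $\psi$ existential; $\mathrm{Sent}$ denotes the sentences among them. $(k(t),t)$ is $k(t)$ as an $\mathfrak{L}_{\mathrm{ring}}(t)$-structure with a constant for $t$. For a formula $\varphi$ with $n$ free variables and structure $M$, $\varphi(M)\subseteq M^n$ is the set it defines; $\mathrm{Var}(\varphi)$ is its set of free variables. -}

module Defs where

open import Level using (Level; _⊔_; Lift; lift; Setω) renaming (zero to lzero)
open import Data.Nat using (ℕ; suc)
open import Data.Fin using (Fin; zero; suc)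
open import Data.List using (List; []; _∷_)
open import Data.List.Relation.Unary.All using (All)
open import Data.Product using (Σ; ∃; ∃₂; _×_; _,_; proj₁; proj₂)
open import Data.Sum using (_⊎_)
open import Data.Empty using (⊥)
open import Data.Unit using (⊤)
open import Function using (_∘_)
open import Function.Bundles using (Inverse; _⇔_)
open import Relation.Nullary using (¬_)
open import Relation.Binary.PropositionalEquality using (_≡_)
import Relation.Binary.PropositionalEquality as ≡
open import Data.Vec.Functional using (Vector) renaming (_∷_ to _∷ᵥ_)
open import Algebra.Bundles using (CommutativeRing)
open import Algebra.Morphism.Structures using (module RingMorphisms)
open import Axiom.ExcludedMiddle using (ExcludedMiddle)

data Lang : Set where
  Lring  : Lang
  LringT : Lang

data Term : Lang → ℕ → Set where
  var    : ∀ {L n} → Fin n → Term L n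
  zero'  : ∀ {L n} → Term L n
  one'   : ∀ {L n} → Term L n
  _+'_   : ∀ {L n} → Term L n → Term L n → Term L n
  _*'_   : ∀ {L n} → Term L n → Term L n → Term L n
  -'_    : ∀ {L n} → Term L n → Term L n
  tconst : ∀ {n} → Term LringT n

data QF (L : Lang) (n : ℕ) : Set where
  _=='_ : Term L n → Term L n → QF L n
  ⊤'    : QF L n
  ⊥'    : QF L n
  ¬'_   : QF L n → QF L n
  _∧'_  : QF L n → QF L n → QF L n
  _∨'_  : QF L n → QF L n → QF L n

data FormEx (L : Lang) : ℕ → Set where
  qf    : ∀ {n} → QF L n → FormEx L n
  _∧ₑ_  : ∀ {n} → FormEx L n → FormEx L n → FormEx L n
  _∨ₑ_  : ∀ {n} → FormEx L n → FormEx L n → FormEx L n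
  ∃ₑ    : ∀ {n} → FormEx L (suc n) → FormEx L n

data FormA1E (L : Lang) (n : ℕ) : Set where
  ex : FormEx L n → FormA1E L n
  ∀ₐ : FormEx L (suc n) → FormA1E L n

FreeT : ∀ {L n} → Fin n → Term L n → Set
FreeT i (var j)  = i ≡ j
FreeT i zero'    = ⊥
FreeT i one'     = ⊥
FreeT i (a +' b) = FreeT i a ⊎ FreeT i b
FreeT i (a *' b) = FreeT i a ⊎ FreeT i b
FreeT i (-' a)   = FreeT i a
FreeT i tconst   = ⊥

FreeQF : ∀ {L n} → Fin n → QF L n → Set
FreeQF i (a ==' b) = FreeT i a ⊎ FreeT i b
FreeQF i ⊤'        = ⊥
FreeQF i ⊥'        = ⊥
FreeQF i (¬' φ)    = FreeQF i φ
FreeQF i (φ ∧' ψ)  = FreeQF i φ ⊎ FreeQF i ψ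
FreeQF i (φ ∨' ψ)  = FreeQF i φ ⊎ FreeQF i ψ

FreeEx : ∀ {L n} → Fin n → FormEx L n → Set
FreeEx i (qf φ)   = FreeQF i φ
FreeEx i (φ ∧ₑ ψ) = FreeEx i φ ⊎ FreeEx i ψ
FreeEx i (φ ∨ₑ ψ) = FreeEx i φ ⊎ FreeEx i ψ
FreeEx i (∃ₑ φ)   = FreeEx (suc i) φ

FreeA : ∀ {L n} → Fin n → FormA1E L n → Set
FreeA i (ex φ) = FreeEx i φ
FreeA i (∀ₐ φ) = FreeEx (suc i) φ

TVal : ∀ {c} → Lang → Set c → Set c
TVal {c} Lring  A = Lift c ⊤
TVal     LringT A = A

module Semantics {c ℓ} (R : CommutativeRing c ℓ) where
  open CommutativeRing R

  evalT : ∀ {L n} → TVal L Carrier → Vector Carrier n → Term L n → Carrier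
  evalT tv ρ (var j)  = ρ j
  evalT tv ρ zero'    = 0#
  evalT tv ρ one'     = 1#
  evalT tv ρ (a +' b) = evalT tv ρ a + evalT tv ρ b
  evalT tv ρ (a *' b) = evalT tv ρ a * evalT tv ρ b
  evalT tv ρ (-' a)   = - evalT tv ρ a
  evalT tv ρ tconst   = tv

  satQF : ∀ {L n} → TVal L Carrier → Vector Carrier n → QF L n → Set ℓ
  satQF tv ρ (a ==' b) = evalT tv ρ a ≈ evalT tv ρ b
  satQF tv ρ ⊤'        = Lift ℓ ⊤
  satQF tv ρ ⊥'        = Lift ℓ ⊥
  satQF tv ρ (¬' φ)    = ¬ satQF tv ρ φ
  satQF tv ρ (φ ∧' ψ)  = satQF tv ρ φ × satQF tv ρ ψ
  satQF tv ρ (φ ∨' ψ)  = satQF tv ρ φ ⊎ satQF tv ρ ψ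

  satEx : ∀ {L n} → TVal L Carrier → Vector Carrier n → FormEx L n → Set (c ⊔ ℓ)
  satEx tv ρ (qf φ)   = Lift c (satQF tv ρ φ)
  satEx tv ρ (φ ∧ₑ ψ) = satEx tv ρ φ × satEx tv ρ ψ
  satEx tv ρ (φ ∨ₑ ψ) = satEx tv ρ φ ⊎ satEx tv ρ ψ
  satEx tv ρ (∃ₑ φ)   = Σ Carrier λ x → satEx tv (x ∷ᵥ ρ) φ

  satA : ∀ {L n} → TVal L Carrier → Vector Carrier n → FormA1E L n → Set (c ⊔ ℓ)
  satA tv ρ (ex φ) = satEx tv ρ φ
  satA tv ρ (∀ₐ φ) = (x : Carrier) → satEx tv (x ∷ᵥ ρ) φ

_⊨ₐ_[_] : ∀ {c ℓ} (R : CommutativeRing c ℓ) {n} → FormA1E Lring n →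
          Vector (CommutativeRing.Carrier R) n → Set (c ⊔ ℓ)
R ⊨ₐ φ [ ρ ] = Semantics.satA R (lift _) ρ φ

_,_⊨ₑ_[_] : ∀ {c ℓ} (R : CommutativeRing c ℓ) (t : CommutativeRing.Carrier R) {n} →
            FormEx LringT n → Vector (CommutativeRing.Carrier R) n → Set (c ⊔ ℓ)
R , t ⊨ₑ φ [ ρ ] = Semantics.satEx R t ρ φ

IsField : ∀ {c ℓ} → CommutativeRing c ℓ → Set (c ⊔ ℓ)
IsField R = ¬ (1# ≈ 0#) × (∀ x → ¬ (x ≈ 0#) → ∃ λ y → x * y ≈ 1#)
  where open CommutativeRing R

data ℕ∞ : Set where
  fin : ℕ → ℕ∞
  ∞   : ℕ∞

HasCard : ∀ {c ℓ} → CommutativeRing c ℓ → ℕ∞ → Set (c ⊔ ℓ)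
HasCard R (fin m) = Inverse (≡.setoid (Fin m)) (CommutativeRing.setoid R)
HasCard R ∞       = ∀ m → ¬ Inverse (≡.setoid (Fin m)) (CommutativeRing.setoid R)

-- The rational function field k(t): a field K with a ring embedding
-- ι : k → K and an element t ∈ K that is transcendental over ι(k) and
-- such that K is the field of fractions of ι(k)[t]. This determines
-- (K, ι, t) up to unique isomorphism, i.e. K ≅ k(t).

module _ {c ℓ c' ℓ'} (k : CommutativeRing c ℓ) (K : CommutativeRing c' ℓ') where
  private
    module k = CommutativeRing k
    module K = CommutativeRing K

  -- evaluation of a polynomial (coefficient list, constant term first)
  evalPoly : (k.Carrier → K.Carrier) → K.Carrier → List k.Carrier → K.Carrier
  evalPoly ι t []      = K.0#
  evalPoly ι t (a ∷ p) = ι a K.+ t K.* evalPoly ι t p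

  record IsRationalFunctionField (ι : k.Carrier → K.Carrier) (t : K.Carrier)
         : Set (c ⊔ ℓ ⊔ c' ⊔ ℓ') where
    field
      field-K       : IsField K
      ι-hom         : RingMorphisms.IsRingHomomorphism k.rawRing K.rawRing ι
      transcendental : ∀ p → evalPoly ι t p K.≈ K.0# → All (k._≈ k.0#) p
      fractions     : ∀ (x : K.Carrier) → ∃₂ λ p q →
                        ¬ (evalPoly ι t q K.≈ K.0#) × (x K.* evalPoly ι t q K.≈ evalPoly ι t p)

-- Shape of Proposition 5.6: a map τ (uniform in q, given as an Agda
-- function, hence computable uniformly in q) with the stated properties.

record Proposition5p6 : Setω where
  field
    τ : ℕ∞ → ∀ {n} → FormA1E Lring n → FormEx LringT n × FormA1E Lring n

    vars : ∀ q {n} (φ : FormA1E Lring n) (i : Fin n) →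
             (FreeEx i (proj₁ (τ q φ)) ⇔ FreeA i φ) ×
             (FreeA  i (proj₂ (τ q φ)) ⇔ FreeA i φ)

    defines : ∀ q {c ℓ c' ℓ'} → ExcludedMiddle (c ⊔ ℓ ⊔ c' ⊔ ℓ') →
              (k : CommutativeRing c ℓ) → IsField k → HasCard k q →
              (K : CommutativeRing c' ℓ') (ι : CommutativeRing.Carrier k → CommutativeRing.Carrier K)
              (t : CommutativeRing.Carrier K) → IsRationalFunctionField k K ι t →
              ∀ {n} (φ : FormA1E Lring n) (a : Vector (CommutativeRing.Carrier k) n) →
              (K ⊨ₐ φ [ ι ∘ a ]) ⇔ ((K , t ⊨ₑ proj₁ (τ q φ) [ ι ∘ a ]) × (k ⊨ₐ proj₂ (τ q φ) [ a ]))

{-# OPTIONS --safe #-}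
-- Every element of k(t) is either a constant or transcendental over k, and for transcendental y
-- the substitution t ↦ y is a k-embedding of k(t) into itself. Embeddings preserve existential
-- formulas, so for a ∈ kⁿ we get k(t) ⊨ ∀x θ(x, a) iff θ(t, a) holds in k(t) and θ(b, a) holds
-- in k(t) for every b ∈ k.
--
-- If k is infinite, θ(b, a) holds in k(t) iff it holds in k: witnesses in k(t) are rational
-- functions, and specialising t to one of infinitely many points of k avoiding finitely many zeros
-- keeps every atomic equality and inequality. So ψ₁ = θ(t, y) and ψ₂ = ∀x θ(x, y).
--
-- If #k = m is finite, "θ(b, a) for all b ∈ k" is said inside k(t) by an existential formula:
-- m distinct elements closed under multiplication are constants (the powers of a transcendental
-- element never repeat), hence they are all of k. Then ψ₂ is a tautology, as it is for
-- existential φ, where ψ₁ = φ.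
module Submission where

open import Level using (_⊔_; Lift; lift; lower)
open import Algebra.Bundles using (CommutativeRing; RawRing)
open import Algebra.Morphism.Structures using (module RingMorphisms)
import Algebra.Morphism.Construct.Identity as Identity
import Algebra.Properties.Ring as RingProperties
import Algebra.Properties.Semiring.Mult as SemiringMult
import Algebra.Solver.Ring
import Algebra.Solver.Ring.AlmostCommutativeRing as ACR
open import Axiom.ExcludedMiddle using (ExcludedMiddle)
open import Data.Empty using (⊥; ⊥-elim)
open import Data.Fin using (Fin; zero; suc; toℕ; _↑ˡ_; _↑ʳ_)
import Data.Fin.Properties as Finₚ
open import Data.Integer as ℤ using (ℤ; +_; -[1+_]; _⊖_)
import Data.Integer.Properties as ℤₚ
open import Data.List as List using (List; []; _∷_; map; length; _++_)
import Data.List.Properties as Listₚ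
open import Data.List.Relation.Unary.All as All using (All; []; _∷_)
import Data.List.Relation.Unary.All.Properties as Allₚ
open import Data.List.Relation.Unary.Any as Any using (Any; here; there)
import Data.List.Relation.Unary.Any.Properties as Anyₚ
open import Data.Maybe using (Maybe; just; nothing)
open import Data.Nat as ℕ using (ℕ; zero; suc; _<_; _≤_; s≤s; z≤n)
import Data.Nat.Properties as ℕₚ
open import Data.Nat.ListAction using (sum)
open import Data.Product using (∃; _×_; _,_; proj₁; proj₂)
open import Data.Product.Function.NonDependent.Propositional using (_×-⇔_)
open import Data.Sign as Sign using (Sign)
open import Data.Sum using (_⊎_; inj₁; inj₂; [_,_]′)
open import Data.Sum.Function.Propositional using (_⊎-⇔_)
open import Data.Unit using (tt)
open import Data.Vec.Functional using (Vector) renaming (_∷_ to _∷ᵥ_)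
open import Function using (_∘_; id)
open import Function.Bundles using (Inverse; Injection; _⇔_; mk⇔; module Equivalence)
open import Function.Properties.Inverse using (Inverse⇒Injection)
import Function.Properties.Equivalence as ⇔
open import Relation.Binary.PropositionalEquality as ≡ using (_≡_; _≢_)
open import Relation.Nullary using (¬_; ¬?; yes; no)
open import Relation.Nullary.Decidable using (map′; decidable-stable)

open import Defs

open Equivalence using (to; from)

-- ℤ maps into every commutative ring, so ℤ-coefficients make the solver of Algebra.Solver.Ring
-- available in an arbitrary commutative ring.
module IntegerCoefficients {c ℓ} (R : CommutativeRing c ℓ) where
  open CommutativeRing R hiding (zero)
  open SemiringMult semiring using (×-homo-+; ×1-homo-*) renaming (_×_ to _·_)
  open RingProperties ring using (-‿involutive; -‿distribˡ-*; -‿distribʳ-*; -‿+-comm; -0#≈0#)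
  open import Relation.Binary.Reasoning.Setoid setoid

  ⟦_⟧ℤ : ℤ → Carrier
  ⟦ + n ⟧ℤ      = n · 1#
  ⟦ -[1+ n ] ⟧ℤ = - (suc n · 1#)

  ⟦⟧ℤ-homo-neg : ∀ z → ⟦ ℤ.- z ⟧ℤ ≈ - ⟦ z ⟧ℤ
  ⟦⟧ℤ-homo-neg (+ zero)  = sym -0#≈0#
  ⟦⟧ℤ-homo-neg (+ suc n) = refl
  ⟦⟧ℤ-homo-neg -[1+ n ]  = sym (-‿involutive _)

  ⟦⟧ℤ-homo-⊖ : ∀ m n → ⟦ m ⊖ n ⟧ℤ ≈ m · 1# - n · 1#
  ⟦⟧ℤ-homo-⊖ m zero = begin
    ⟦ m ⊖ zero ⟧ℤ  ≡⟨ ≡.cong ⟦_⟧ℤ (ℤₚ.⊖-≥ {m} {zero} z≤n) ⟩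
    m · 1#         ≈⟨ sym (+-identityʳ _) ⟩
    m · 1# + 0#    ≈⟨ +-congˡ (sym -0#≈0#) ⟩
    m · 1# - 0#    ∎
  ⟦⟧ℤ-homo-⊖ zero (suc n) = sym (+-identityˡ _)
  ⟦⟧ℤ-homo-⊖ (suc m) (suc n) = begin
    ⟦ suc m ⊖ suc n ⟧ℤ          ≡⟨ ≡.cong ⟦_⟧ℤ (ℤₚ.[1+m]⊖[1+n]≡m⊖n m n) ⟩
    ⟦ m ⊖ n ⟧ℤ                  ≈⟨ ⟦⟧ℤ-homo-⊖ m n ⟩
    m · 1# - n · 1#             ≈⟨ shift (m · 1#) (n · 1#) ⟩
    (1# + m · 1#) - (1# + n · 1#) ∎
    where
    shift : ∀ a b → a - b ≈ (1# + a) - (1# + b)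
    shift a b = begin
      a - b                   ≈⟨ sym (+-identityˡ _) ⟩
      0# + (a - b)            ≈⟨ +-congʳ (sym (-‿inverseʳ 1#)) ⟩
      (1# - 1#) + (a - b)     ≈⟨ +-assoc _ _ _ ⟩
      1# + (- 1# + (a - b))   ≈⟨ +-congˡ (sym (+-assoc _ _ _)) ⟩
      1# + ((- 1# + a) - b)   ≈⟨ +-congˡ (+-congʳ (+-comm _ _)) ⟩
      1# + ((a - 1#) - b)     ≈⟨ +-congˡ (+-assoc _ _ _) ⟩
      1# + (a + (- 1# - b))   ≈⟨ +-congˡ (+-congˡ (-‿+-comm 1# b)) ⟩
      1# + (a - (1# + b))     ≈⟨ sym (+-assoc _ _ _) ⟩
      (1# + a) - (1# + b)     ∎

  ⟦⟧ℤ-homo-+ : ∀ x y → ⟦ x ℤ.+ y ⟧ℤ ≈ ⟦ x ⟧ℤ + ⟦ y ⟧ℤ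
  ⟦⟧ℤ-homo-+ -[1+ m ] -[1+ n ] = begin
    - (suc (suc (m ℕ.+ n)) · 1#)    ≡⟨ ≡.cong (λ k → - (k · 1#)) (≡.sym (ℕₚ.+-suc (suc m) n)) ⟩
    - ((suc m ℕ.+ suc n) · 1#)      ≈⟨ -‿cong (×-homo-+ 1# (suc m) (suc n)) ⟩
    - (suc m · 1# + suc n · 1#)     ≈⟨ sym (-‿+-comm _ _) ⟩
    - (suc m · 1#) - (suc n · 1#)   ∎
  ⟦⟧ℤ-homo-+ -[1+ m ] (+ n) = trans (⟦⟧ℤ-homo-⊖ n (suc m)) (+-comm _ _)
  ⟦⟧ℤ-homo-+ (+ m) -[1+ n ] = ⟦⟧ℤ-homo-⊖ m (suc n)
  ⟦⟧ℤ-homo-+ (+ m) (+ n)    = ×-homo-+ 1# m n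

  sign : Sign → Carrier
  sign Sign.+ = 1#
  sign Sign.- = - 1#

  sign-homo-* : ∀ s t → sign (s Sign.* t) ≈ sign s * sign t
  sign-homo-* Sign.+ _      = sym (*-identityˡ _)
  sign-homo-* Sign.- Sign.+ = sym (*-identityʳ _)
  sign-homo-* Sign.- Sign.- = begin
    1#               ≈⟨ sym (-‿involutive _) ⟩
    - - 1#           ≈⟨ -‿cong (-‿cong (sym (*-identityˡ _))) ⟩
    - - (1# * 1#)    ≈⟨ -‿cong (-‿distribˡ-* _ _) ⟩
    - (- 1# * 1#)    ≈⟨ -‿distribʳ-* _ _ ⟩
    - 1# * - 1#      ∎

  ⟦◃⟧ℤ : ∀ s n → ⟦ s ℤ.◃ n ⟧ℤ ≈ sign s * (n · 1#)
  ⟦◃⟧ℤ s      zero    = sym (zeroʳ _)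
  ⟦◃⟧ℤ Sign.+ (suc n) = sym (*-identityˡ _)
  ⟦◃⟧ℤ Sign.- (suc n) = trans (-‿cong (sym (*-identityˡ _))) (-‿distribˡ-* _ _)

  ⟦⟧ℤ-sign-abs : ∀ z → ⟦ z ⟧ℤ ≈ sign (ℤ.sign z) * (ℤ.∣ z ∣ · 1#)
  ⟦⟧ℤ-sign-abs (+ n)    = sym (*-identityˡ _)
  ⟦⟧ℤ-sign-abs -[1+ n ] = trans (-‿cong (sym (*-identityˡ _))) (-‿distribˡ-* _ _)

  ⟦⟧ℤ-homo-* : ∀ x y → ⟦ x ℤ.* y ⟧ℤ ≈ ⟦ x ⟧ℤ * ⟦ y ⟧ℤ
  ⟦⟧ℤ-homo-* x y = begin
    ⟦ x ℤ.* y ⟧ℤ                                ≈⟨ ⟦◃⟧ℤ (ℤ.sign x Sign.* ℤ.sign y) (ℤ.∣ x ∣ ℕ.* ℤ.∣ y ∣) ⟩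
    sign (ℤ.sign x Sign.* ℤ.sign y) * ((ℤ.∣ x ∣ ℕ.* ℤ.∣ y ∣) · 1#)
                                                ≈⟨ *-cong (sign-homo-* (ℤ.sign x) (ℤ.sign y)) (×1-homo-* ℤ.∣ x ∣ ℤ.∣ y ∣) ⟩
    (sx * sy) * (ax * ay)                       ≈⟨ interchange sx sy ax ay ⟩
    (sx * ax) * (sy * ay)                       ≈⟨ sym (*-cong (⟦⟧ℤ-sign-abs x) (⟦⟧ℤ-sign-abs y)) ⟩
    ⟦ x ⟧ℤ * ⟦ y ⟧ℤ                             ∎
    where
    sx = sign (ℤ.sign x)
    sy = sign (ℤ.sign y)
    ax = ℤ.∣ x ∣ · 1#
    ay = ℤ.∣ y ∣ · 1#
    interchange : ∀ a b d e → (a * b) * (d * e) ≈ (a * d) * (b * e)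
    interchange a b d e = begin
      (a * b) * (d * e)   ≈⟨ *-assoc _ _ _ ⟩
      a * (b * (d * e))   ≈⟨ *-congˡ (sym (*-assoc _ _ _)) ⟩
      a * ((b * d) * e)   ≈⟨ *-congˡ (*-congʳ (*-comm _ _)) ⟩
      a * ((d * b) * e)   ≈⟨ *-congˡ (*-assoc _ _ _) ⟩
      a * (d * (b * e))   ≈⟨ sym (*-assoc _ _ _) ⟩
      (a * d) * (b * e)   ∎

  ℤ-rawRing : RawRing _ _
  ℤ-rawRing = record
    { Carrier = ℤ ; _≈_ = _≡_ ; _+_ = ℤ._+_ ; _*_ = ℤ._*_ ; -_ = ℤ.-_ ; 0# = + 0 ; 1# = + 1 }

  almostCommutativeRing : ACR.AlmostCommutativeRing c ℓ
  almostCommutativeRing = ACR.fromCommutativeRing R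

  ⟦⟧ℤ-morphism : ℤ-rawRing ACR.-Raw-AlmostCommutative⟶ almostCommutativeRing
  ⟦⟧ℤ-morphism = record
    { ⟦_⟧ = ⟦_⟧ℤ ; +-homo = ⟦⟧ℤ-homo-+ ; *-homo = ⟦⟧ℤ-homo-* ; -‿homo = ⟦⟧ℤ-homo-neg
    ; 0-homo = refl ; 1-homo = +-identityʳ 1# }

  ⟦⟧ℤ-≟ : ∀ a b → Maybe (⟦ a ⟧ℤ ≈ ⟦ b ⟧ℤ)
  ⟦⟧ℤ-≟ a b with a ℤₚ.≟ b
  ... | yes ≡.refl = just refl
  ... | no _       = nothing

  open Algebra.Solver.Ring ℤ-rawRing almostCommutativeRing ⟦⟧ℤ-morphism ⟦⟧ℤ-≟ public

IsRingHomomorphism : ∀ {c ℓ c′ ℓ′} (R : CommutativeRing c ℓ) (S : CommutativeRing c′ ℓ′) →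
                     (CommutativeRing.Carrier R → CommutativeRing.Carrier S) → Set (c ⊔ ℓ ⊔ ℓ′)
IsRingHomomorphism R S =
  RingMorphisms.IsRingHomomorphism (CommutativeRing.rawRing R) (CommutativeRing.rawRing S)

IsRingMonomorphism : ∀ {c ℓ c′ ℓ′} (R : CommutativeRing c ℓ) (S : CommutativeRing c′ ℓ′) →
                     (CommutativeRing.Carrier R → CommutativeRing.Carrier S) → Set (c ⊔ ℓ ⊔ ℓ′)
IsRingMonomorphism R S =
  RingMorphisms.IsRingMonomorphism (CommutativeRing.rawRing R) (CommutativeRing.rawRing S)

lowerExcludedMiddle : ∀ {a} b → ExcludedMiddle (a ⊔ b) → ExcludedMiddle a
lowerExcludedMiddle b em = map′ (lower {ℓ = b}) lift em

-- Polynomials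

module Polynomial {c ℓ} (k : CommutativeRing c ℓ) where
  open CommutativeRing k
  open RingProperties ring using (-0#≈0#; -‿involutive)

  Poly : Set c
  Poly = List Carrier

  IsZero : Poly → Set (c ⊔ ℓ)
  IsZero = All (_≈ 0#)

  infixl 6 _⊕_ _⊝_
  infixl 7 _⊗_

  _⊕_ : Poly → Poly → Poly
  []      ⊕ q       = q
  (a ∷ p) ⊕ []      = a ∷ p
  (a ∷ p) ⊕ (b ∷ q) = (a + b) ∷ (p ⊕ q)

  ⊖_ : Poly → Poly
  ⊖_ = map (λ a → - a)

  scale : Carrier → Poly → Poly
  scale a = map (a *_)

  _⊗_ : Poly → Poly → Poly
  []      ⊗ q = []
  (a ∷ p) ⊗ q = scale a q ⊕ (0# ∷ (p ⊗ q))

  _⊝_ : Poly → Poly → Poly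
  p ⊝ q = p ⊕ ⊖ q

  constant : Carrier → Poly
  constant a = a ∷ []

  X : Poly
  X = 0# ∷ 1# ∷ []

  X^ : ℕ → Poly
  X^ zero    = 1# ∷ []
  X^ (suc n) = 0# ∷ X^ n

  _⊗^_ : Poly → ℕ → Poly
  p ⊗^ zero  = constant 1#
  p ⊗^ suc n = p ⊗ (p ⊗^ n)

  X^-⊝-X^-≉0 : ¬ 1# ≈ 0# → ∀ a b → a ≢ b → ¬ IsZero (X^ a ⊝ X^ b)
  X^-⊝-X^-≉0 1≉0 zero    zero    a≢b _          = a≢b ≡.refl
  X^-⊝-X^-≉0 1≉0 zero    (suc b) a≢b (1-0≈0 ∷ _) = 1≉0 (trans (sym (trans (+-congˡ -0#≈0#) (+-identityʳ 1#))) 1-0≈0)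
  X^-⊝-X^-≉0 1≉0 (suc a) zero    a≢b (0-1≈0 ∷ _) =
    1≉0 (trans (sym (-‿involutive 1#)) (trans (-‿cong (trans (sym (+-identityˡ _)) 0-1≈0)) -0#≈0#))
  X^-⊝-X^-≉0 1≉0 (suc a) (suc b) a≢b (_ ∷ rest≈0) = X^-⊝-X^-≉0 1≉0 a b (a≢b ∘ ≡.cong suc) rest≈0

module Evaluation {c ℓ c′ ℓ′} (k : CommutativeRing c ℓ) (K : CommutativeRing c′ ℓ′)
                  {ι : CommutativeRing.Carrier k → CommutativeRing.Carrier K}
                  (ι-hom : IsRingHomomorphism k K ι) where
  open Polynomial k
  private module k = CommutativeRing k
  open CommutativeRing K
  open RingMorphisms.IsRingHomomorphism ι-hom
  open RingProperties ring using (-0#≈0#; -‿distribˡ-*)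
  open import Algebra.Definitions.RawSemiring (RawRing.rawSemiring rawRing) using (_^_)
  open import Relation.Binary.Reasoning.Setoid setoid
  open IntegerCoefficients K using (solve; _:=_; _:+_; _:*_; :-_)

  eval : Carrier → Poly → Carrier
  eval = evalPoly k K ι

  eval-⊕ : ∀ s p q → eval s (p ⊕ q) ≈ eval s p + eval s q
  eval-⊕ s []      q       = sym (+-identityˡ _)
  eval-⊕ s (a ∷ p) []      = sym (+-identityʳ _)
  eval-⊕ s (a ∷ p) (b ∷ q) = begin
    ι (a k.+ b) + s * eval s (p ⊕ q)    ≈⟨ +-cong (+-homo a b) (*-congˡ (eval-⊕ s p q)) ⟩
    (ι a + ι b) + s * (eval s p + eval s q)
      ≈⟨ solve 5 (λ A B S P Q → (A :+ B) :+ S :* (P :+ Q) := (A :+ S :* P) :+ (B :+ S :* Q))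
               refl (ι a) (ι b) s (eval s p) (eval s q) ⟩
    (ι a + s * eval s p) + (ι b + s * eval s q) ∎

  eval-⊖ : ∀ s p → eval s (⊖ p) ≈ - eval s p
  eval-⊖ s []      = sym -0#≈0#
  eval-⊖ s (a ∷ p) = begin
    ι (k.- a) + s * eval s (⊖ p)    ≈⟨ +-cong (-‿homo a) (*-congˡ (eval-⊖ s p)) ⟩
    - ι a + s * - eval s p          ≈⟨ solve 3 (λ A S P → :- A :+ S :* (:- P) := :- (A :+ S :* P)) refl (ι a) s (eval s p) ⟩
    - (ι a + s * eval s p)          ∎

  eval-scale : ∀ s a p → eval s (scale a p) ≈ ι a * eval s p
  eval-scale s a []      = sym (zeroʳ _)
  eval-scale s a (b ∷ p) = begin
    ι (a k.* b) + s * eval s (scale a p)   ≈⟨ +-cong (*-homo a b) (*-congˡ (eval-scale s a p)) ⟩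
    ι a * ι b + s * (ι a * eval s p)       ≈⟨ solve 4 (λ A B S P → A :* B :+ S :* (A :* P) := A :* (B :+ S :* P))
                                                      refl (ι a) (ι b) s (eval s p) ⟩
    ι a * (ι b + s * eval s p)             ∎

  eval-⊗ : ∀ s p q → eval s (p ⊗ q) ≈ eval s p * eval s q
  eval-⊗ s []      q = sym (zeroˡ _)
  eval-⊗ s (a ∷ p) q = begin
    eval s (scale a q ⊕ (k.0# ∷ (p ⊗ q)))             ≈⟨ eval-⊕ s (scale a q) (k.0# ∷ (p ⊗ q)) ⟩
    eval s (scale a q) + (ι k.0# + s * eval s (p ⊗ q))
      ≈⟨ +-cong (eval-scale s a q) (+-cong 0#-homo (*-congˡ (eval-⊗ s p q))) ⟩
    ι a * eval s q + (0# + s * (eval s p * eval s q))  ≈⟨ +-congˡ (+-identityˡ _) ⟩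
    ι a * eval s q + s * (eval s p * eval s q)
      ≈⟨ solve 4 (λ A Q S P → A :* Q :+ S :* (P :* Q) := (A :+ S :* P) :* Q) refl (ι a) (eval s q) s (eval s p) ⟩
    (ι a + s * eval s p) * eval s q                    ∎

  eval-⊝ : ∀ s p q → eval s (p ⊝ q) ≈ eval s p - eval s q
  eval-⊝ s p q = trans (eval-⊕ s p (⊖ q)) (+-congˡ (eval-⊖ s q))

  eval-constant : ∀ s a → eval s (constant a) ≈ ι a
  eval-constant s a = trans (+-congˡ (zeroʳ s)) (+-identityʳ _)

  eval-1 : ∀ s → eval s (constant k.1#) ≈ 1#
  eval-1 s = trans (eval-constant s k.1#) 1#-homo

  eval-X : ∀ s → eval s X ≈ s
  eval-X s = begin
    ι k.0# + s * eval s (constant k.1#)  ≈⟨ +-cong 0#-homo (*-congˡ (eval-1 s)) ⟩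
    0# + s * 1#                          ≈⟨ trans (+-identityˡ _) (*-identityʳ s) ⟩
    s                                    ∎

  eval-X^ : ∀ s n → eval s (X^ n) ≈ s ^ n
  eval-X^ s zero    = eval-1 s
  eval-X^ s (suc n) = trans (+-cong 0#-homo (*-congˡ (eval-X^ s n))) (+-identityˡ _)

  eval-⊗^ : ∀ s p n → eval s (p ⊗^ n) ≈ eval s p ^ n
  eval-⊗^ s p zero    = eval-1 s
  eval-⊗^ s p (suc n) = trans (eval-⊗ s p (p ⊗^ n)) (*-congˡ (eval-⊗^ s p n))

  eval-IsZero : ∀ s {p} → IsZero p → eval s p ≈ 0#
  eval-IsZero s []                     = refl
  eval-IsZero s {a ∷ p} (a≈0 ∷ p≈0) = begin
    ι a + s * eval s p   ≈⟨ +-cong (trans (⟦⟧-cong a≈0) 0#-homo) (*-congˡ (eval-IsZero s p≈0)) ⟩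
    0# + s * 0#          ≈⟨ trans (+-identityˡ _) (zeroʳ s) ⟩
    0#                   ∎

  eval-map : ∀ s p → eval s p ≡ evalPoly K K id s (map ι p)
  eval-map s []      = ≡.refl
  eval-map s (a ∷ p) = ≡.cong (λ z → ι a + s * z) (eval-map s p)

module FieldProperties {c ℓ} (F : CommutativeRing c ℓ) (isField : IsField F) where
  open CommutativeRing F
  open import Relation.Binary.Reasoning.Setoid setoid
  open IntegerCoefficients F using (solve; _:=_; _:+_; _:*_; _:-_)
  open import Algebra.Definitions.RawSemiring (RawRing.rawSemiring rawRing) using (_^_)

  1≉0 : ¬ 1# ≈ 0#
  1≉0 = proj₁ isField

  inverse : ∀ x → ¬ x ≈ 0# → Carrier
  inverse x x≉0 = proj₁ (proj₂ isField x x≉0)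

  *-inverseʳ : ∀ x x≉0 → x * inverse x x≉0 ≈ 1#
  *-inverseʳ x x≉0 = proj₂ (proj₂ isField x x≉0)

  quotient : Carrier → ∀ x → ¬ x ≈ 0# → Carrier
  quotient a x x≉0 = a * inverse x x≉0

  quotient-* : ∀ a x x≉0 → quotient a x x≉0 * x ≈ a
  quotient-* a x x≉0 = begin
    (a * inverse x x≉0) * x   ≈⟨ *-assoc _ _ _ ⟩
    a * (inverse x x≉0 * x)   ≈⟨ *-congˡ (trans (*-comm _ _) (*-inverseʳ x x≉0)) ⟩
    a * 1#                    ≈⟨ *-identityʳ a ⟩
    a                         ∎

  *-cancelʳ : ∀ {a b x} → ¬ x ≈ 0# → a * x ≈ b * x → a ≈ b
  *-cancelʳ {a} {b} {x} x≉0 ax≈bx = begin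
    a                                   ≈⟨ sym (quotient-* a x x≉0) ⟩
    (a * inverse x x≉0) * x             ≈⟨ *-congʳ (*-comm _ _) ⟩
    (inverse x x≉0 * a) * x             ≈⟨ *-assoc _ _ _ ⟩
    inverse x x≉0 * (a * x)             ≈⟨ *-congˡ ax≈bx ⟩
    inverse x x≉0 * (b * x)             ≈⟨ sym (*-assoc _ _ _) ⟩
    (inverse x x≉0 * b) * x             ≈⟨ *-congʳ (*-comm _ _) ⟩
    (b * inverse x x≉0) * x             ≈⟨ quotient-* b x x≉0 ⟩
    b                                   ∎

  *-cancelˡ : ∀ {a b x} → ¬ x ≈ 0# → x * a ≈ x * b → a ≈ b
  *-cancelˡ {a} {b} {x} x≉0 xa≈xb = *-cancelʳ x≉0 (trans (*-comm a x) (trans xa≈xb (*-comm x b)))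

  *≈0⇒≈0 : ∀ {a x} → ¬ x ≈ 0# → x * a ≈ 0# → a ≈ 0#
  *≈0⇒≈0 {a} {x} x≉0 xa≈0 = *-cancelˡ x≉0 (trans xa≈0 (sym (zeroʳ x)))

  *-≉0 : ∀ {a b} → ¬ a ≈ 0# → ¬ b ≈ 0# → ¬ a * b ≈ 0#
  *-≉0 {a} {b} a≉0 b≉0 ab≈0 = b≉0 (*≈0⇒≈0 a≉0 ab≈0)

  ^-≉0 : ∀ {y} n → ¬ y ≈ 0# → ¬ y ^ n ≈ 0#
  ^-≉0 zero    y≉0 = 1≉0
  ^-≉0 (suc n) y≉0 = *-≉0 y≉0 (^-≉0 n y≉0)

  x-y≈0⇒x≈y : ∀ {a b} → a - b ≈ 0# → a ≈ b
  x-y≈0⇒x≈y {a} {b} a-b≈0 = begin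
    a              ≈⟨ solve 2 (λ A B → A := (A :- B) :+ B) refl a b ⟩
    (a - b) + b    ≈⟨ +-congʳ a-b≈0 ⟩
    0# + b         ≈⟨ +-identityˡ b ⟩
    b              ∎

  x≈y⇒x-y≈0 : ∀ {a b} → a ≈ b → a - b ≈ 0#
  x≈y⇒x-y≈0 {a} {b} a≈b = trans (+-congʳ a≈b) (-‿inverseʳ b)

module PolynomialRoots {c ℓ} (F : CommutativeRing c ℓ) (isField : IsField F)
                       (em : ExcludedMiddle (c ⊔ ℓ)) where
  open CommutativeRing F
  open FieldProperties F isField
  open Polynomial F
  open Evaluation F F (Identity.isRingHomomorphism rawRing refl) public
  open import Data.List.Membership.Setoid setoid using (_∈_)
  open import Relation.Binary.Reasoning.Setoid setoid
  open IntegerCoefficients F using (solve; _:=_; _:+_; _:*_; _:-_; con)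

  emℓ : ExcludedMiddle ℓ
  emℓ = lowerExcludedMiddle c em

  zero-product : ∀ {a b} → a * b ≈ 0# → a ≈ 0# ⊎ b ≈ 0#
  zero-product {a} {b} ab≈0 with emℓ {a ≈ 0#}
  ... | yes a≈0 = inj₁ a≈0
  ... | no  a≉0 = inj₂ (*≈0⇒≈0 a≉0 ab≈0)

  divideByLinear : Carrier → Poly → Poly
  divideByLinear r []          = []
  divideByLinear r (a ∷ [])    = []
  divideByLinear r (a ∷ b ∷ p) = eval r (b ∷ p) ∷ divideByLinear r (b ∷ p)

  length-divideByLinear : ∀ r a p → length (divideByLinear r (a ∷ p)) ≡ length p
  length-divideByLinear r a []      = ≡.refl
  length-divideByLinear r a (b ∷ p) = ≡.cong suc (length-divideByLinear r b p)

  eval-divideByLinear : ∀ r s p → eval s p ≈ (s - r) * eval s (divideByLinear r p) + eval r p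
  eval-divideByLinear r s [] =
    solve 2 (λ S R → con (+ 0) := (S :- R) :* con (+ 0) :+ con (+ 0)) refl s r
  eval-divideByLinear r s (a ∷ []) =
    solve 3 (λ A S R → A :+ S :* con (+ 0) := (S :- R) :* con (+ 0) :+ (A :+ R :* con (+ 0))) refl a s r
  eval-divideByLinear r s (a ∷ b ∷ p) = begin
    a + s * eval s (b ∷ p)              ≈⟨ +-congˡ (*-congˡ (eval-divideByLinear r s (b ∷ p))) ⟩
    a + s * ((s - r) * D + P)           ≈⟨ solve 5 (λ A S R D P → A :+ S :* ((S :- R) :* D :+ P) :=
                                                    (S :- R) :* (P :+ S :* D) :+ (A :+ R :* P)) refl a s r D P ⟩
    (s - r) * (P + s * D) + (a + r * P) ∎
    where D = eval s (divideByLinear r (b ∷ p))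
          P = eval r (b ∷ p)

  IsZero-divideByLinear : ∀ r p → IsZero (divideByLinear r p) → eval r p ≈ 0# → IsZero p
  IsZero-divideByLinear r []          _            _    = []
  IsZero-divideByLinear r (a ∷ [])    _            pr≈0 = trans (sym (eval-constant r a)) pr≈0 ∷ []
  IsZero-divideByLinear r (a ∷ b ∷ p) (q≈0 ∷ qs≈0) pr≈0 = a≈0 ∷ IsZero-divideByLinear r (b ∷ p) qs≈0 q≈0
    where
    a≈0 : a ≈ 0#
    a≈0 = begin
      a                      ≈⟨ sym (+-identityʳ a) ⟩
      a + 0#                 ≈⟨ +-congˡ (sym (trans (*-congˡ q≈0) (zeroʳ r))) ⟩
      a + r * eval r (b ∷ p) ≈⟨ pr≈0 ⟩
      0#                     ∎

  RootsIn : Poly → List Carrier → Set (c ⊔ ℓ)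
  RootsIn p C = ∀ s → eval s p ≈ 0# → s ∈ C

  -- The fuel n bounds the length of p, which drops by one with each root divided out.
  roots-bounded : ∀ n p → length p ≤ n → ¬ IsZero p → ∃ λ C → length C < length p × RootsIn p C
  roots-bounded n [] _ p≉0 = ⊥-elim (p≉0 [])
  roots-bounded n (a ∷ p) _ _ with em {∃ λ r → eval r (a ∷ p) ≈ 0#}
  ... | no noRoot = [] , s≤s z≤n , λ s ps≈0 → ⊥-elim (noRoot (s , ps≈0))
  roots-bounded (suc n) (a ∷ p) (s≤s |p|≤n) ap≉0 | yes (r , ar≈0)
    with roots-bounded n q (≡.subst (_≤ n) (≡.sym (length-divideByLinear r a p)) |p|≤n)
                           (λ q≈0 → ap≉0 (IsZero-divideByLinear r (a ∷ p) q≈0 ar≈0))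
    where q = divideByLinear r (a ∷ p)
  ... | C , |C|<|q| , rootsC =
    r ∷ C , s≤s (≡.subst (length C <_) (length-divideByLinear r a p) |C|<|q|) , roots
    where
    q = divideByLinear r (a ∷ p)
    roots : RootsIn (a ∷ p) (r ∷ C)
    roots s ps≈0 with zero-product {s - r} {eval s q} (begin
      (s - r) * eval s q                    ≈⟨ sym (+-identityʳ _) ⟩
      (s - r) * eval s q + 0#               ≈⟨ +-congˡ (sym ar≈0) ⟩
      (s - r) * eval s q + eval r (a ∷ p)   ≈⟨ sym (eval-divideByLinear r s (a ∷ p)) ⟩
      eval s (a ∷ p)                        ≈⟨ ps≈0 ⟩
      0#                                    ∎)
    ... | inj₁ s-r≈0 = here (x-y≈0⇒x≈y s-r≈0)
    ... | inj₂ qs≈0  = there (rootsC s qs≈0)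

  roots-finite : ∀ p → ¬ IsZero p → ∃ λ C → length C < length p × RootsIn p C
  roots-finite p = roots-bounded (length p) p ℕₚ.≤-refl

  rootsOfAll-finite : ∀ ps → All (¬_ ∘ IsZero) ps →
                      ∃ λ C → length C ≤ sum (map length ps) × All (λ p → RootsIn p C) ps
  rootsOfAll-finite []       []           = [] , z≤n , []
  rootsOfAll-finite (p ∷ ps) (p≉0 ∷ ps≉0) with roots-finite p p≉0 | rootsOfAll-finite ps ps≉0
  ... | C , |C|<|p| , rootsC | D , |D|≤ , rootsD =
    C ++ D ,
    ≡.subst (_≤ length p ℕ.+ sum (map length ps)) (≡.sym (Listₚ.length-++ C))
            (ℕₚ.+-mono-≤ (ℕₚ.<⇒≤ |C|<|p|) |D|≤) ,
    (λ s ps≈0 → Anyₚ.++⁺ˡ (rootsC s ps≈0)) ∷ All.map (λ rootsP s ps≈0 → Anyₚ.++⁺ʳ C (rootsP s ps≈0)) rootsD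

  avoidRoots : ∀ ps → All (¬_ ∘ IsZero) ps → ∀ {N} → sum (map length ps) < N →
               (v : Fin N → Carrier) → (∀ i j → v i ≈ v j → i ≡ j) →
               ∃ λ i → All (λ p → ¬ eval (v i) p ≈ 0#) ps
  avoidRoots ps ps≉0 {N} bound v v-injective with em {∃ λ i → All (λ p → ¬ eval (v i) p ≈ 0#) ps}
  ... | yes found = found
  ... | no none   = ⊥-elim (Finₚ.<⇒≢ i<j (v-injective i j vi≈vj))
    where
    roots = rootsOfAll-finite ps ps≉0
    C = proj₁ roots
    isRoot : ∀ i → v i ∈ C
    isRoot i = All.lookupWith (λ rootsP ¬¬root → rootsP (v i) (decidable-stable emℓ ¬¬root))
                              (proj₂ (proj₂ roots))
                              (Allₚ.¬All⇒Any¬ (λ _ → ¬? emℓ) ps (λ avoids → none (i , avoids)))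
    collision = Finₚ.pigeonhole (ℕₚ.≤-<-trans (proj₁ (proj₂ roots)) bound) (Any.index ∘ isRoot)
    i = proj₁ collision
    j = proj₁ (proj₂ collision)
    i<j = proj₁ (proj₂ (proj₂ collision))
    vi≈vj : v i ≈ v j
    vi≈vj = trans (Anyₚ.lookup-index (isRoot i))
              (sym (≡.subst (λ m → v j ≈ List.lookup C m) (≡.sym (proj₂ (proj₂ (proj₂ collision))))
                            (Anyₚ.lookup-index (isRoot j))))

module TermFractions {c ℓ} (k : CommutativeRing c ℓ) {n : ℕ} (P Q : Fin n → Polynomial.Poly k) where
  open Polynomial k
  open CommutativeRing k using (1#)

  numerator   : Term Lring n → Poly
  denominator : Term Lring n → Poly
  numerator (var j)  = P j
  numerator zero'    = []
  numerator one'     = constant 1#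
  numerator (a +' b) = numerator a ⊗ denominator b ⊕ numerator b ⊗ denominator a
  numerator (a *' b) = numerator a ⊗ numerator b
  numerator (-' a)   = ⊖ numerator a
  denominator (var j)  = Q j
  denominator zero'    = constant 1#
  denominator one'     = constant 1#
  denominator (a +' b) = denominator a ⊗ denominator b
  denominator (a *' b) = denominator a ⊗ denominator b
  denominator (-' a)   = denominator a

  equationPoly : Term Lring n → Term Lring n → Poly
  equationPoly a b = numerator a ⊗ denominator b ⊝ numerator b ⊗ denominator a

module Fractions {c ℓ c′ ℓ′} (k : CommutativeRing c ℓ) (F : CommutativeRing c′ ℓ′) (isField : IsField F)
                 {h : CommutativeRing.Carrier k → CommutativeRing.Carrier F}
                 (h-hom : IsRingHomomorphism k F h) where
  open Polynomial k
  private module k = CommutativeRing k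
  open CommutativeRing F
  open Evaluation k F h-hom
  open FieldProperties F isField
  open RingMorphisms.IsRingHomomorphism h-hom using (1#-homo)
  open RingProperties ring using (-‿distribˡ-*)
  open import Relation.Binary.Reasoning.Setoid setoid
  open IntegerCoefficients F using (solve; _:=_; _:+_; _:*_)

  FractionAt : Carrier → Poly → Poly → Carrier → Set ℓ′
  FractionAt s P Q u = u * eval s Q ≈ eval s P

  module _ (s : Carrier) {u u′} (P Q P′ Q′ : Poly) (u≈P/Q : FractionAt s P Q u) (u′≈P′/Q′ : FractionAt s P′ Q′ u′) where

    fraction-+ : FractionAt s (P ⊗ Q′ ⊕ P′ ⊗ Q) (Q ⊗ Q′) (u + u′)
    fraction-+ = begin
      (u + u′) * eval s (Q ⊗ Q′)                   ≈⟨ *-congˡ (eval-⊗ s Q Q′) ⟩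
      (u + u′) * (eval s Q * eval s Q′)
        ≈⟨ solve 4 (λ U U′ A B → (U :+ U′) :* (A :* B) := (U :* A) :* B :+ (U′ :* B) :* A) refl u u′ (eval s Q) (eval s Q′) ⟩
      (u * eval s Q) * eval s Q′ + (u′ * eval s Q′) * eval s Q
                                                   ≈⟨ +-cong (*-congʳ u≈P/Q) (*-congʳ u′≈P′/Q′) ⟩
      eval s P * eval s Q′ + eval s P′ * eval s Q  ≈⟨ sym (+-cong (eval-⊗ s P Q′) (eval-⊗ s P′ Q)) ⟩
      eval s (P ⊗ Q′) + eval s (P′ ⊗ Q)            ≈⟨ sym (eval-⊕ s (P ⊗ Q′) (P′ ⊗ Q)) ⟩
      eval s (P ⊗ Q′ ⊕ P′ ⊗ Q)                     ∎

    fraction-* : FractionAt s (P ⊗ P′) (Q ⊗ Q′) (u * u′)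
    fraction-* = begin
      (u * u′) * eval s (Q ⊗ Q′)          ≈⟨ *-congˡ (eval-⊗ s Q Q′) ⟩
      (u * u′) * (eval s Q * eval s Q′)
        ≈⟨ solve 4 (λ U U′ A B → (U :* U′) :* (A :* B) := (U :* A) :* (U′ :* B)) refl u u′ (eval s Q) (eval s Q′) ⟩
      (u * eval s Q) * (u′ * eval s Q′)   ≈⟨ *-cong u≈P/Q u′≈P′/Q′ ⟩
      eval s P * eval s P′                ≈⟨ sym (eval-⊗ s P P′) ⟩
      eval s (P ⊗ P′)                     ∎

    fraction-≈⇒cross : u ≈ u′ → eval s (P ⊗ Q′) ≈ eval s (P′ ⊗ Q)
    fraction-≈⇒cross u≈u′ = begin
      eval s (P ⊗ Q′)                ≈⟨ eval-⊗ s P Q′ ⟩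
      eval s P * eval s Q′           ≈⟨ *-congʳ (sym u≈P/Q) ⟩
      (u * eval s Q) * eval s Q′     ≈⟨ *-congʳ (*-congʳ u≈u′) ⟩
      (u′ * eval s Q) * eval s Q′
        ≈⟨ solve 3 (λ U A B → (U :* A) :* B := (U :* B) :* A) refl u′ (eval s Q) (eval s Q′) ⟩
      (u′ * eval s Q′) * eval s Q    ≈⟨ *-congʳ u′≈P′/Q′ ⟩
      eval s P′ * eval s Q           ≈⟨ sym (eval-⊗ s P′ Q) ⟩
      eval s (P′ ⊗ Q)                ∎

    cross⇒fraction-≈ : ¬ eval s Q ≈ 0# → ¬ eval s Q′ ≈ 0# → eval s (P ⊗ Q′) ≈ eval s (P′ ⊗ Q) → u ≈ u′
    cross⇒fraction-≈ Q≉0 Q′≉0 cross = *-cancelʳ (*-≉0 Q≉0 Q′≉0) (begin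
      u * (eval s Q * eval s Q′)     ≈⟨ sym (*-assoc _ _ _) ⟩
      (u * eval s Q) * eval s Q′     ≈⟨ *-congʳ u≈P/Q ⟩
      eval s P * eval s Q′           ≈⟨ sym (eval-⊗ s P Q′) ⟩
      eval s (P ⊗ Q′)                ≈⟨ cross ⟩
      eval s (P′ ⊗ Q)                ≈⟨ eval-⊗ s P′ Q ⟩
      eval s P′ * eval s Q           ≈⟨ *-congʳ (sym u′≈P′/Q′) ⟩
      (u′ * eval s Q′) * eval s Q
        ≈⟨ solve 3 (λ U A B → (U :* B) :* A := U :* (A :* B)) refl u′ (eval s Q) (eval s Q′) ⟩
      u′ * (eval s Q * eval s Q′)    ∎)

  fraction-neg : ∀ s P Q {u} → FractionAt s P Q u → FractionAt s (⊖ P) Q (- u)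
  fraction-neg s P Q {u} u≈P/Q = trans (sym (-‿distribˡ-* u (eval s Q))) (trans (-‿cong u≈P/Q) (sym (eval-⊖ s P)))

  fraction-constant : ∀ s a → FractionAt s (constant a) (constant k.1#) (h a)
  fraction-constant s a = trans (*-congˡ (eval-1 s)) (trans (*-identityʳ _) (sym (eval-constant s a)))

  fraction-X : ∀ s → FractionAt s X (constant k.1#) s
  fraction-X s = trans (*-congˡ (eval-1 s)) (trans (*-identityʳ s) (sym (eval-X s)))

  fraction-quotient : ∀ s P Q (Q≉0 : ¬ eval s Q ≈ 0#) → FractionAt s P Q (quotient (eval s P) (eval s Q) Q≉0)
  fraction-quotient s P Q = quotient-* (eval s P) (eval s Q)

  eval-⊗-≉0 : ∀ s Q Q′ → ¬ eval s Q ≈ 0# → ¬ eval s Q′ ≈ 0# → ¬ eval s (Q ⊗ Q′) ≈ 0#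
  eval-⊗-≉0 s Q Q′ Q≉0 Q′≉0 QQ′≈0 = *-≉0 Q≉0 Q′≉0 (trans (sym (eval-⊗ s Q Q′)) QQ′≈0)

  eval-1-≉0 : ∀ s → ¬ eval s (constant k.1#) ≈ 0#
  eval-1-≉0 s 1≈0 = 1≉0 (trans (sym (eval-1 s)) 1≈0)

  module _ {n} (P Q : Fin n → Poly) (s : Carrier) (ρ : Vector Carrier n)
           (Q≉0 : ∀ j → ¬ eval s (Q j) ≈ 0#) (ρ≈P/Q : ∀ j → FractionAt s (P j) (Q j) (ρ j)) where
    open TermFractions k P Q
    open Semantics F using (evalT)

    denominator-≉0 : ∀ a → ¬ eval s (denominator a) ≈ 0#
    denominator-≉0 (var j)  = Q≉0 j
    denominator-≉0 zero'    = eval-1-≉0 s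
    denominator-≉0 one'     = eval-1-≉0 s
    denominator-≉0 (a +' b) = eval-⊗-≉0 s (denominator a) (denominator b) (denominator-≉0 a) (denominator-≉0 b)
    denominator-≉0 (a *' b) = eval-⊗-≉0 s (denominator a) (denominator b) (denominator-≉0 a) (denominator-≉0 b)
    denominator-≉0 (-' a)   = denominator-≉0 a

    term-fraction : ∀ a → FractionAt s (numerator a) (denominator a) (evalT (lift tt) ρ a)
    term-fraction (var j)  = ρ≈P/Q j
    term-fraction zero'    = zeroˡ _
    term-fraction one'     = *-identityˡ _
    term-fraction (a +' b) =
      fraction-+ s (numerator a) (denominator a) (numerator b) (denominator b) (term-fraction a) (term-fraction b)
    term-fraction (a *' b) =
      fraction-* s (numerator a) (denominator a) (numerator b) (denominator b) (term-fraction a) (term-fraction b)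
    term-fraction (-' a)   = fraction-neg s (numerator a) (denominator a) (term-fraction a)

    equation⇔equationPoly : ∀ a b → (evalT (lift tt) ρ a ≈ evalT (lift tt) ρ b) ⇔ (eval s (equationPoly a b) ≈ 0#)
    equation⇔equationPoly a b = mk⇔
      (λ a≈b → trans (eval-⊝ s NaDb NbDa) (x≈y⇒x-y≈0 (fraction-≈⇒cross s Na Da Nb Db a≈ b≈ a≈b)))
      (λ eq≈0 → cross⇒fraction-≈ s Na Da Nb Db a≈ b≈ (denominator-≉0 a) (denominator-≉0 b)
                  (x-y≈0⇒x≈y (trans (sym (eval-⊝ s NaDb NbDa)) eq≈0)))
      where
      a≈ = term-fraction a
      b≈ = term-fraction b
      Na = numerator a
      Da = denominator a
      Nb = numerator b
      Db = denominator b
      NaDb = Na ⊗ Db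
      NbDa = Nb ⊗ Da

-- Substitution and free variables

renameT : ∀ {L n m} → (Fin n → Fin m) → Term L n → Term L m
renameT g (var j)  = var (g j)
renameT g zero'    = zero'
renameT g one'     = one'
renameT g (a +' b) = renameT g a +' renameT g b
renameT g (a *' b) = renameT g a *' renameT g b
renameT g (-' a)   = -' renameT g a
renameT g tconst   = tconst

Substitution : Lang → ℕ → ℕ → Set
Substitution L n m = Fin n → Term L m

-- Substitutions start from L_ring, so they serve both as the inclusion of L_ring-formulas into
-- L_ring(t) (substitute var) and as instantiation of a variable at t.
substT : ∀ {L n m} → Substitution L n m → Term Lring n → Term L m
substT f (var j)  = f j
substT f zero'    = zero'
substT f one'     = one'
substT f (a +' b) = substT f a +' substT f b
substT f (a *' b) = substT f a *' substT f b
substT f (-' a)   = -' substT f a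

substQF : ∀ {L n m} → Substitution L n m → QF Lring n → QF L m
substQF f (a ==' b) = substT f a ==' substT f b
substQF f ⊤'        = ⊤'
substQF f ⊥'        = ⊥'
substQF f (¬' φ)    = ¬' substQF f φ
substQF f (φ ∧' ψ)  = substQF f φ ∧' substQF f ψ
substQF f (φ ∨' ψ)  = substQF f φ ∨' substQF f ψ

extend : ∀ {L n m} → Substitution L n m → Substitution L (suc n) (suc m)
extend f zero    = var zero
extend f (suc j) = renameT suc (f j)

substEx : ∀ {L n m} → Substitution L n m → FormEx Lring n → FormEx L m
substEx f (qf φ)   = qf (substQF f φ)
substEx f (φ ∧ₑ ψ) = substEx f φ ∧ₑ substEx f ψ
substEx f (φ ∨ₑ ψ) = substEx f φ ∨ₑ substEx f ψ
substEx f (∃ₑ φ)   = ∃ₑ (substEx (extend f) φ)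

FreeT-renameT-suc : ∀ {L n} (i : Fin n) (a : Term L n) → FreeT (suc i) (renameT suc a) ⇔ FreeT i a
FreeT-renameT-suc i (var j)  = mk⇔ Finₚ.suc-injective (≡.cong suc)
FreeT-renameT-suc i zero'    = ⇔.refl
FreeT-renameT-suc i one'     = ⇔.refl
FreeT-renameT-suc i (a +' b) = FreeT-renameT-suc i a ⊎-⇔ FreeT-renameT-suc i b
FreeT-renameT-suc i (a *' b) = FreeT-renameT-suc i a ⊎-⇔ FreeT-renameT-suc i b
FreeT-renameT-suc i (-' a)   = FreeT-renameT-suc i a
FreeT-renameT-suc i tconst   = ⇔.refl

FreeVia : ∀ {L n m} → (Fin n → Set) → Substitution L n m → Fin m → Set
FreeVia {n = n} Free f i = ∃ λ j → Free j × FreeT i (f j)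

private
  FreeVia-⊎ : ∀ {L n m} {A B : Set} {FreeA FreeB : Fin n → Set} (f : Substitution L n m) i →
              A ⇔ FreeVia FreeA f i → B ⇔ FreeVia FreeB f i → (A ⊎ B) ⇔ FreeVia (λ j → FreeA j ⊎ FreeB j) f i
  FreeVia-⊎ f i A⇔ B⇔ = mk⇔
    (λ { (inj₁ a) → let (j , p , q) = to A⇔ a in j , inj₁ p , q
       ; (inj₂ b) → let (j , p , q) = to B⇔ b in j , inj₂ p , q })
    (λ { (j , inj₁ p , q) → inj₁ (from A⇔ (j , p , q))
       ; (j , inj₂ p , q) → inj₂ (from B⇔ (j , p , q)) })

  FreeVia-⊥ : ∀ {L n m} (f : Substitution L n m) i → ⊥ ⇔ FreeVia (λ _ → ⊥) f i
  FreeVia-⊥ f i = mk⇔ (λ ()) (λ { (_ , () , _) })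

FreeT-substT : ∀ {L n m} (f : Substitution L n m) i (a : Term Lring n) →
               FreeT i (substT f a) ⇔ FreeVia (λ j → FreeT j a) f i
FreeT-substT f i (var j)  = mk⇔ (λ free → j , ≡.refl , free) (λ { (_ , ≡.refl , free) → free })
FreeT-substT f i zero'    = FreeVia-⊥ f i
FreeT-substT f i one'     = FreeVia-⊥ f i
FreeT-substT f i (a +' b) = FreeVia-⊎ f i (FreeT-substT f i a) (FreeT-substT f i b)
FreeT-substT f i (a *' b) = FreeVia-⊎ f i (FreeT-substT f i a) (FreeT-substT f i b)
FreeT-substT f i (-' a)   = FreeT-substT f i a

FreeQF-substQF : ∀ {L n m} (f : Substitution L n m) i (φ : QF Lring n) →
                 FreeQF i (substQF f φ) ⇔ FreeVia (λ j → FreeQF j φ) f i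
FreeQF-substQF f i (a ==' b) = FreeVia-⊎ f i (FreeT-substT f i a) (FreeT-substT f i b)
FreeQF-substQF f i ⊤'        = FreeVia-⊥ f i
FreeQF-substQF f i ⊥'        = FreeVia-⊥ f i
FreeQF-substQF f i (¬' φ)    = FreeQF-substQF f i φ
FreeQF-substQF f i (φ ∧' ψ)  = FreeVia-⊎ f i (FreeQF-substQF f i φ) (FreeQF-substQF f i ψ)
FreeQF-substQF f i (φ ∨' ψ)  = FreeVia-⊎ f i (FreeQF-substQF f i φ) (FreeQF-substQF f i ψ)

FreeEx-substEx : ∀ {L n m} (f : Substitution L n m) i (φ : FormEx Lring n) →
                 FreeEx i (substEx f φ) ⇔ FreeVia (λ j → FreeEx j φ) f i
FreeEx-substEx f i (qf φ)   = FreeQF-substQF f i φ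
FreeEx-substEx f i (φ ∧ₑ ψ) = FreeVia-⊎ f i (FreeEx-substEx f i φ) (FreeEx-substEx f i ψ)
FreeEx-substEx f i (φ ∨ₑ ψ) = FreeVia-⊎ f i (FreeEx-substEx f i φ) (FreeEx-substEx f i ψ)
FreeEx-substEx f i (∃ₑ φ)   = ⇔.trans (FreeEx-substEx (extend f) (suc i) φ) (mk⇔ unextend reextend)
  where
  unextend : FreeVia (λ j → FreeEx j φ) (extend f) (suc i) → FreeVia (λ j → FreeEx (suc j) φ) f i
  unextend (suc j , free , freeT) = j , free , to (FreeT-renameT-suc i (f j)) freeT
  reextend : FreeVia (λ j → FreeEx (suc j) φ) f i → FreeVia (λ j → FreeEx j φ) (extend f) (suc i)
  reextend (j , free , freeT) = suc j , free , from (FreeT-renameT-suc i (f j)) freeT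

FreeEx-substEx-var : ∀ {L n} i (φ : FormEx Lring n) → FreeEx i (substEx {L} var φ) ⇔ FreeEx i φ
FreeEx-substEx-var i φ = ⇔.trans (FreeEx-substEx var i φ)
  (mk⇔ (λ { (_ , free , ≡.refl) → free }) (λ free → i , free , ≡.refl))

module SubstitutionLemma {c ℓ} (R : CommutativeRing c ℓ) where
  open CommutativeRing R
  open Semantics R

  evalT-renameT : ∀ {L n m} tv (ρ : Vector Carrier m) (g : Fin n → Fin m) (a : Term L n) →
                  evalT tv ρ (renameT g a) ≡ evalT tv (ρ ∘ g) a
  evalT-renameT tv ρ g (var j)  = ≡.refl
  evalT-renameT tv ρ g zero'    = ≡.refl
  evalT-renameT tv ρ g one'     = ≡.refl
  evalT-renameT tv ρ g (a +' b) = ≡.cong₂ _+_ (evalT-renameT tv ρ g a) (evalT-renameT tv ρ g b)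
  evalT-renameT tv ρ g (a *' b) = ≡.cong₂ _*_ (evalT-renameT tv ρ g a) (evalT-renameT tv ρ g b)
  evalT-renameT tv ρ g (-' a)   = ≡.cong -_ (evalT-renameT tv ρ g a)
  evalT-renameT tv ρ g tconst   = ≡.refl

  module _ {L n m} (tv : TVal L Carrier) (ρ : Vector Carrier m) (f : Substitution L n m) (σ : Vector Carrier n)
           (σ≈f : ∀ j → σ j ≈ evalT tv ρ (f j)) where

    evalT-substT : ∀ a → evalT (lift tt) σ a ≈ evalT tv ρ (substT f a)
    evalT-substT (var j)  = σ≈f j
    evalT-substT zero'    = refl
    evalT-substT one'     = refl
    evalT-substT (a +' b) = +-cong (evalT-substT a) (evalT-substT b)
    evalT-substT (a *' b) = *-cong (evalT-substT a) (evalT-substT b)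
    evalT-substT (-' a)   = -‿cong (evalT-substT a)

    satQF-substQF : ∀ φ → satQF (lift tt) σ φ ⇔ satQF tv ρ (substQF f φ)
    satQF-substQF (a ==' b) = mk⇔
      (λ a≈b → trans (sym (evalT-substT a)) (trans a≈b (evalT-substT b)))
      (λ a≈b → trans (evalT-substT a) (trans a≈b (sym (evalT-substT b))))
    satQF-substQF ⊤'       = mk⇔ (λ _ → lift tt) (λ _ → lift tt)
    satQF-substQF ⊥'       = mk⇔ (λ ()) (λ ())
    satQF-substQF (¬' φ)   = mk⇔ (λ ¬sat sat → ¬sat (from (satQF-substQF φ) sat))
                                 (λ ¬sat sat → ¬sat (to (satQF-substQF φ) sat))
    satQF-substQF (φ ∧' ψ) = satQF-substQF φ ×-⇔ satQF-substQF ψ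
    satQF-substQF (φ ∨' ψ) = satQF-substQF φ ⊎-⇔ satQF-substQF ψ

  satEx-substEx : ∀ {L n m} tv (ρ : Vector Carrier m) (f : Substitution L n m) (σ : Vector Carrier n) →
                  (∀ j → σ j ≈ evalT tv ρ (f j)) → ∀ φ → satEx (lift tt) σ φ ⇔ satEx tv ρ (substEx f φ)
  satEx-substEx tv ρ f σ σ≈f (qf φ)   = mk⇔ (lift ∘ to (satQF-substQF tv ρ f σ σ≈f φ) ∘ lower)
                                            (lift ∘ from (satQF-substQF tv ρ f σ σ≈f φ) ∘ lower)
  satEx-substEx tv ρ f σ σ≈f (φ ∧ₑ ψ) = satEx-substEx tv ρ f σ σ≈f φ ×-⇔ satEx-substEx tv ρ f σ σ≈f ψ
  satEx-substEx tv ρ f σ σ≈f (φ ∨ₑ ψ) = satEx-substEx tv ρ f σ σ≈f φ ⊎-⇔ satEx-substEx tv ρ f σ σ≈f ψ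
  satEx-substEx tv ρ f σ σ≈f (∃ₑ φ)   = mk⇔
    (λ { (x , sat) → x , to (IH x) sat }) (λ { (x , sat) → x , from (IH x) sat })
    where
    σ≈extend : ∀ x j → (x ∷ᵥ σ) j ≈ evalT tv (x ∷ᵥ ρ) (extend f j)
    σ≈extend x zero    = refl
    σ≈extend x (suc j) = trans (σ≈f j) (reflexive (≡.sym (evalT-renameT tv (x ∷ᵥ ρ) suc (f j))))
    IH : ∀ x → satEx (lift tt) (x ∷ᵥ σ) φ ⇔ satEx tv (x ∷ᵥ ρ) (substEx (extend f) φ)
    IH x = satEx-substEx tv (x ∷ᵥ ρ) (extend f) (x ∷ᵥ σ) (σ≈extend x) φ

module Preservation {c ℓ c′ ℓ′} {R : CommutativeRing c ℓ} {S : CommutativeRing c′ ℓ′}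
                    {h : CommutativeRing.Carrier R → CommutativeRing.Carrier S}
                    (h-mono : IsRingMonomorphism R S h) where
  private
    module R = CommutativeRing R
    module S = CommutativeRing S
    module SemR = Semantics R
    module SemS = Semantics S
  open RingMorphisms.IsRingMonomorphism h-mono

  module _ {n} (ρR : Vector R.Carrier n) (ρS : Vector S.Carrier n) (ρS≈hρR : ∀ j → ρS j S.≈ h (ρR j)) where

    evalT-homo : ∀ a → SemS.evalT (lift tt) ρS a S.≈ h (SemR.evalT (lift tt) ρR a)
    evalT-homo (var j)  = ρS≈hρR j
    evalT-homo zero'    = S.sym 0#-homo
    evalT-homo one'     = S.sym 1#-homo
    evalT-homo (a +' b) = S.trans (S.+-cong (evalT-homo a) (evalT-homo b)) (S.sym (+-homo _ _))
    evalT-homo (a *' b) = S.trans (S.*-cong (evalT-homo a) (evalT-homo b)) (S.sym (*-homo _ _))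
    evalT-homo (-' a)   = S.trans (S.-‿cong (evalT-homo a)) (S.sym (-‿homo _))

    satQF-homo : ∀ φ → SemR.satQF (lift tt) ρR φ ⇔ SemS.satQF (lift tt) ρS φ
    satQF-homo (a ==' b) = mk⇔
      (λ a≈b → S.trans (evalT-homo a) (S.trans (⟦⟧-cong a≈b) (S.sym (evalT-homo b))))
      (λ a≈b → injective (S.trans (S.sym (evalT-homo a)) (S.trans a≈b (evalT-homo b))))
    satQF-homo ⊤'       = mk⇔ (λ _ → lift tt) (λ _ → lift tt)
    satQF-homo ⊥'       = mk⇔ (λ ()) (λ ())
    satQF-homo (¬' φ)   = mk⇔ (λ ¬sat sat → ¬sat (from (satQF-homo φ) sat))
                              (λ ¬sat sat → ¬sat (to (satQF-homo φ) sat))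
    satQF-homo (φ ∧' ψ) = satQF-homo φ ×-⇔ satQF-homo ψ
    satQF-homo (φ ∨' ψ) = satQF-homo φ ⊎-⇔ satQF-homo ψ

  satEx-homo : ∀ {n} (ρR : Vector R.Carrier n) (ρS : Vector S.Carrier n) → (∀ j → ρS j S.≈ h (ρR j)) →
               ∀ φ → SemR.satEx (lift tt) ρR φ → SemS.satEx (lift tt) ρS φ
  satEx-homo ρR ρS ρS≈hρR (qf φ)   (lift sat)     = lift (to (satQF-homo ρR ρS ρS≈hρR φ) sat)
  satEx-homo ρR ρS ρS≈hρR (φ ∧ₑ ψ) (satφ , satψ) = satEx-homo ρR ρS ρS≈hρR φ satφ , satEx-homo ρR ρS ρS≈hρR ψ satψ
  satEx-homo ρR ρS ρS≈hρR (φ ∨ₑ ψ) (inj₁ sat)     = inj₁ (satEx-homo ρR ρS ρS≈hρR φ sat)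
  satEx-homo ρR ρS ρS≈hρR (φ ∨ₑ ψ) (inj₂ sat)     = inj₂ (satEx-homo ρR ρS ρS≈hρR ψ sat)
  satEx-homo ρR ρS ρS≈hρR (∃ₑ φ)   (x , sat)      = h x , satEx-homo (x ∷ᵥ ρR) (h x ∷ᵥ ρS) extended φ sat
    where
    extended : ∀ j → (h x ∷ᵥ ρS) j S.≈ h ((x ∷ᵥ ρR) j)
    extended zero    = S.refl
    extended (suc j) = ρS≈hρR j

satEx-cong : ∀ {c ℓ} (R : CommutativeRing c ℓ) {n} (ρ ρ′ : Vector (CommutativeRing.Carrier R) n) →
             (∀ j → CommutativeRing._≈_ R (ρ′ j) (ρ j)) →
             ∀ φ → Semantics.satEx R (lift tt) ρ φ → Semantics.satEx R (lift tt) ρ′ φ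
satEx-cong R = Preservation.satEx-homo (Identity.isRingMonomorphism (CommutativeRing.rawRing R) (CommutativeRing.refl R))

tautologyQF : ∀ {L n} → QF L n → QF L n
tautologyQF (a ==' b) = (a ==' a) ∧' (b ==' b)
tautologyQF ⊤'        = ⊤'
tautologyQF ⊥'        = ⊤'
tautologyQF (¬' φ)    = tautologyQF φ
tautologyQF (φ ∧' ψ)  = tautologyQF φ ∧' tautologyQF ψ
tautologyQF (φ ∨' ψ)  = tautologyQF φ ∧' tautologyQF ψ

tautologyEx : ∀ {L n} → FormEx L n → FormEx L n
tautologyEx (qf φ)   = qf (tautologyQF φ)
tautologyEx (φ ∧ₑ ψ) = tautologyEx φ ∧ₑ tautologyEx ψ
tautologyEx (φ ∨ₑ ψ) = tautologyEx φ ∧ₑ tautologyEx ψ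
tautologyEx (∃ₑ φ)   = ∃ₑ (tautologyEx φ)

private
  ⊎-idem : ∀ {A : Set} → (A ⊎ A) ⇔ A
  ⊎-idem = mk⇔ (λ { (inj₁ a) → a ; (inj₂ a) → a }) inj₁

FreeQF-tautologyQF : ∀ {L n} i (φ : QF L n) → FreeQF i (tautologyQF φ) ⇔ FreeQF i φ
FreeQF-tautologyQF i (a ==' b) = ⊎-idem ⊎-⇔ ⊎-idem
FreeQF-tautologyQF i ⊤'        = ⇔.refl
FreeQF-tautologyQF i ⊥'        = ⇔.refl
FreeQF-tautologyQF i (¬' φ)    = FreeQF-tautologyQF i φ
FreeQF-tautologyQF i (φ ∧' ψ)  = FreeQF-tautologyQF i φ ⊎-⇔ FreeQF-tautologyQF i ψ
FreeQF-tautologyQF i (φ ∨' ψ)  = FreeQF-tautologyQF i φ ⊎-⇔ FreeQF-tautologyQF i ψ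

FreeEx-tautologyEx : ∀ {L n} i (φ : FormEx L n) → FreeEx i (tautologyEx φ) ⇔ FreeEx i φ
FreeEx-tautologyEx i (qf φ)   = FreeQF-tautologyQF i φ
FreeEx-tautologyEx i (φ ∧ₑ ψ) = FreeEx-tautologyEx i φ ⊎-⇔ FreeEx-tautologyEx i ψ
FreeEx-tautologyEx i (φ ∨ₑ ψ) = FreeEx-tautologyEx i φ ⊎-⇔ FreeEx-tautologyEx i ψ
FreeEx-tautologyEx i (∃ₑ φ)   = FreeEx-tautologyEx (suc i) φ

⋀ : ∀ {L n} m → (Fin m → QF L n) → QF L n
⋀ zero    φ = ⊤'
⋀ (suc m) φ = φ zero ∧' ⋀ m (φ ∘ suc)

⋁ : ∀ {L n} m → (Fin m → QF L n) → QF L n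
⋁ zero    φ = ⊥'
⋁ (suc m) φ = φ zero ∨' ⋁ m (φ ∘ suc)

⋀ₑ : ∀ {L n} m → (Fin m → FormEx L n) → FormEx L n
⋀ₑ zero    φ = qf ⊤'
⋀ₑ (suc m) φ = φ zero ∧ₑ ⋀ₑ m (φ ∘ suc)

∃ⁿ : ∀ {L n} m → FormEx L (m ℕ.+ n) → FormEx L n
∃ⁿ zero    φ = φ
∃ⁿ (suc m) φ = ∃ⁿ m (∃ₑ φ)

FreeQF-⋀ : ∀ {L n} m (φ : Fin m → QF L n) i → FreeQF i (⋀ m φ) → ∃ λ l → FreeQF i (φ l)
FreeQF-⋀ (suc m) φ i (inj₁ free) = zero , free
FreeQF-⋀ (suc m) φ i (inj₂ free) = let (l , free′) = FreeQF-⋀ m (φ ∘ suc) i free in suc l , free′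

FreeQF-⋁ : ∀ {L n} m (φ : Fin m → QF L n) i → FreeQF i (⋁ m φ) → ∃ λ l → FreeQF i (φ l)
FreeQF-⋁ (suc m) φ i (inj₁ free) = zero , free
FreeQF-⋁ (suc m) φ i (inj₂ free) = let (l , free′) = FreeQF-⋁ m (φ ∘ suc) i free in suc l , free′

FreeEx-⋀ₑ : ∀ {L n} m (φ : Fin m → FormEx L n) i → FreeEx i (⋀ₑ m φ) → ∃ λ l → FreeEx i (φ l)
FreeEx-⋀ₑ (suc m) φ i (inj₁ free) = zero , free
FreeEx-⋀ₑ (suc m) φ i (inj₂ free) = let (l , free′) = FreeEx-⋀ₑ m (φ ∘ suc) i free in suc l , free′

FreeEx-∃ⁿ : ∀ {L n} m (φ : FormEx L (m ℕ.+ n)) i → FreeEx i (∃ⁿ m φ) → FreeEx (m ↑ʳ i) φ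
FreeEx-∃ⁿ zero    φ i free = free
FreeEx-∃ⁿ (suc m) φ i free = FreeEx-∃ⁿ m (∃ₑ φ) i free

prepend : ∀ {a} {A : Set a} {m n} → Vector A m → Vector A n → Vector A (m ℕ.+ n)
prepend {m = zero}  w ρ = ρ
prepend {m = suc m} w ρ = w zero ∷ᵥ prepend (w ∘ suc) ρ

prepend-↑ˡ : ∀ {a} {A : Set a} {m n} (w : Vector A m) (ρ : Vector A n) i → prepend w ρ (i ↑ˡ n) ≡ w i
prepend-↑ˡ w ρ zero    = ≡.refl
prepend-↑ˡ w ρ (suc i) = prepend-↑ˡ (w ∘ suc) ρ i

prepend-↑ʳ : ∀ {a} {A : Set a} {m n} (w : Vector A m) (ρ : Vector A n) j → prepend w ρ (m ↑ʳ j) ≡ ρ j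
prepend-↑ʳ {m = zero}  w ρ j = ≡.refl
prepend-↑ʳ {m = suc m} w ρ j = prepend-↑ʳ (w ∘ suc) ρ j

module ConnectiveSemantics {c ℓ} (R : CommutativeRing c ℓ) where
  open CommutativeRing R using (Carrier; 0#; refl)
  open Semantics R

  satQF-tautologyQF : ∀ {L n} tv (ρ : Vector Carrier n) (φ : QF L n) → satQF tv ρ (tautologyQF φ)
  satQF-tautologyQF tv ρ (a ==' b) = refl , refl
  satQF-tautologyQF tv ρ ⊤'        = lift tt
  satQF-tautologyQF tv ρ ⊥'        = lift tt
  satQF-tautologyQF tv ρ (¬' φ)    = satQF-tautologyQF tv ρ φ
  satQF-tautologyQF tv ρ (φ ∧' ψ)  = satQF-tautologyQF tv ρ φ , satQF-tautologyQF tv ρ ψ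
  satQF-tautologyQF tv ρ (φ ∨' ψ)  = satQF-tautologyQF tv ρ φ , satQF-tautologyQF tv ρ ψ

  satEx-tautologyEx : ∀ {L n} tv (ρ : Vector Carrier n) (φ : FormEx L n) → satEx tv ρ (tautologyEx φ)
  satEx-tautologyEx tv ρ (qf φ)   = lift (satQF-tautologyQF tv ρ φ)
  satEx-tautologyEx tv ρ (φ ∧ₑ ψ) = satEx-tautologyEx tv ρ φ , satEx-tautologyEx tv ρ ψ
  satEx-tautologyEx tv ρ (φ ∨ₑ ψ) = satEx-tautologyEx tv ρ φ , satEx-tautologyEx tv ρ ψ
  satEx-tautologyEx tv ρ (∃ₑ φ)   = 0# , satEx-tautologyEx tv (0# ∷ᵥ ρ) φ

  satQF-⋀ : ∀ {L n} tv (ρ : Vector Carrier n) m (φ : Fin m → QF L n) → satQF tv ρ (⋀ m φ) ⇔ (∀ i → satQF tv ρ (φ i))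
  satQF-⋀ tv ρ zero    φ = mk⇔ (λ _ ()) (λ _ → lift tt)
  satQF-⋀ tv ρ (suc m) φ = mk⇔
    (λ { (sat₀ , sats) zero → sat₀ ; (sat₀ , sats) (suc i) → to (satQF-⋀ tv ρ m (φ ∘ suc)) sats i })
    (λ sat → sat zero , from (satQF-⋀ tv ρ m (φ ∘ suc)) (sat ∘ suc))

  satQF-⋁ : ∀ {L n} tv (ρ : Vector Carrier n) m (φ : Fin m → QF L n) → satQF tv ρ (⋁ m φ) ⇔ (∃ λ i → satQF tv ρ (φ i))
  satQF-⋁ tv ρ zero    φ = mk⇔ (λ ()) (λ { (() , _) })
  satQF-⋁ tv ρ (suc m) φ = mk⇔
    (λ { (inj₁ sat) → zero , sat ; (inj₂ sat) → let (i , sat′) = to (satQF-⋁ tv ρ m (φ ∘ suc)) sat in suc i , sat′ })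
    (λ { (zero , sat) → inj₁ sat ; (suc i , sat) → inj₂ (from (satQF-⋁ tv ρ m (φ ∘ suc)) (i , sat)) })

  satEx-⋀ₑ : ∀ {L n} tv (ρ : Vector Carrier n) m (φ : Fin m → FormEx L n) → satEx tv ρ (⋀ₑ m φ) ⇔ (∀ i → satEx tv ρ (φ i))
  satEx-⋀ₑ tv ρ zero    φ = mk⇔ (λ _ ()) (λ _ → lift (lift tt))
  satEx-⋀ₑ tv ρ (suc m) φ = mk⇔
    (λ { (sat₀ , sats) zero → sat₀ ; (sat₀ , sats) (suc i) → to (satEx-⋀ₑ tv ρ m (φ ∘ suc)) sats i })
    (λ sat → sat zero , from (satEx-⋀ₑ tv ρ m (φ ∘ suc)) (sat ∘ suc))

  satEx-∃ⁿ : ∀ {L n} tv (ρ : Vector Carrier n) m (φ : FormEx L (m ℕ.+ n)) →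
             satEx tv ρ (∃ⁿ m φ) ⇔ (∃ λ (w : Vector Carrier m) → satEx tv (prepend w ρ) φ)
  satEx-∃ⁿ tv ρ zero    φ = mk⇔ (λ sat → (λ ()) , sat) proj₂
  satEx-∃ⁿ tv ρ (suc m) φ = mk⇔
    (λ sat → let (w , x , sat′) = to (satEx-∃ⁿ tv ρ m (∃ₑ φ)) sat in x ∷ᵥ w , sat′)
    (λ { (w , sat) → from (satEx-∃ⁿ tv ρ m (∃ₑ φ)) (w ∘ suc , w zero , sat) })

-- The rational function field

module RationalFunctionField {c ℓ c′ ℓ′} (k : CommutativeRing c ℓ) (K : CommutativeRing c′ ℓ′)
  {ι : CommutativeRing.Carrier k → CommutativeRing.Carrier K} {t : CommutativeRing.Carrier K}
  (rff : IsRationalFunctionField k K ι t) (k-field : IsField k)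
  (em : ExcludedMiddle (c ⊔ ℓ ⊔ c′ ⊔ ℓ′)) where

  open IsRationalFunctionField rff
  private
    module k = CommutativeRing k
    module Fk = FieldProperties k k-field
    module FK = FieldProperties K field-K
    module PK = Polynomial K
    module RK = PolynomialRoots K field-K (lowerExcludedMiddle (c ⊔ ℓ) em)
  open CommutativeRing K
  open RingMorphisms.IsRingHomomorphism ι-hom
  open Polynomial k
  open Evaluation k K ι-hom
  open Fractions k K field-K ι-hom
  open import Algebra.Definitions.RawSemiring (RawRing.rawSemiring rawRing) using (_^_)
  open import Relation.Binary.Reasoning.Setoid setoid

  ι-≉0 : ∀ {a} → ¬ a k.≈ k.0# → ¬ ι a ≈ 0#
  ι-≉0 {a} a≉0 ιa≈0 = FK.1≉0 (begin
    1#                              ≈⟨ sym 1#-homo ⟩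
    ι k.1#                          ≈⟨ ⟦⟧-cong (k.sym (Fk.*-inverseʳ a a≉0)) ⟩
    ι (a k.* Fk.inverse a a≉0)      ≈⟨ *-homo _ _ ⟩
    ι a * ι (Fk.inverse a a≉0)      ≈⟨ *-congʳ ιa≈0 ⟩
    0# * ι (Fk.inverse a a≉0)       ≈⟨ zeroˡ _ ⟩
    0#                              ∎)

  ι-injective : ∀ {a b} → ι a ≈ ι b → a k.≈ b
  ι-injective {a} {b} ιa≈ιb with lowerExcludedMiddle (c ⊔ c′ ⊔ ℓ′) em {a k.≈ b}
  ... | yes a≈b = a≈b
  ... | no  a≉b = ⊥-elim (ι-≉0 (a≉b ∘ Fk.x-y≈0⇒x≈y)
          (trans (+-homo a (k.- b)) (trans (+-congˡ (-‿homo b)) (FK.x≈y⇒x-y≈0 ιa≈ιb))))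

  ι-mono : IsRingMonomorphism k K ι
  ι-mono = record { isRingHomomorphism = ι-hom ; injective = ι-injective }

  IsZero-map⁻ : ∀ p → PK.IsZero (map ι p) → IsZero p
  IsZero-map⁻ []      []            = []
  IsZero-map⁻ (a ∷ p) (ιa≈0 ∷ p≈0) = ι-injective (trans ιa≈0 (sym 0#-homo)) ∷ IsZero-map⁻ p p≈0

  IsConstant : Carrier → Set (c ⊔ ℓ′)
  IsConstant x = ∃ λ a → x ≈ ι a

  Transcendental : Carrier → Set (c ⊔ ℓ ⊔ ℓ′)
  Transcendental x = ∀ p → eval x p ≈ 0# → IsZero p

  eval-≉0⇒≉0 : ∀ {s} q → ¬ eval s q ≈ 0# → ¬ IsZero q
  eval-≉0⇒≉0 {s} q qs≉0 q≈0 = qs≉0 (eval-IsZero s q≈0)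

  transfer : ∀ {s} → Transcendental s → ∀ u p q → eval s p ≈ eval s q → eval u p ≈ eval u q
  transfer {s} s-transcendental u p q ps≈qs = FK.x-y≈0⇒x≈y (begin
    eval u p - eval u q   ≈⟨ sym (eval-⊝ u p q) ⟩
    eval u (p ⊝ q)        ≈⟨ eval-IsZero u (s-transcendental (p ⊝ q) (trans (eval-⊝ s p q) (FK.x≈y⇒x-y≈0 ps≈qs))) ⟩
    0#                    ∎)

  ^-injective : ∀ {y} → Transcendental y → ∀ a b → y ^ a ≈ y ^ b → a ≡ b
  ^-injective {y} y-transcendental a b yᵃ≈yᵇ with a ℕₚ.≟ b
  ... | yes a≡b = a≡b
  ... | no  a≢b = ⊥-elim (X^-⊝-X^-≉0 Fk.1≉0 a b a≢b (y-transcendental (X^ a ⊝ X^ b)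
          (trans (eval-⊝ y (X^ a) (X^ b)) (FK.x≈y⇒x-y≈0 (trans (eval-X^ y a) (trans yᵃ≈yᵇ (sym (eval-X^ y b))))))))

  homogenise : Poly → Poly → Poly → Poly
  homogenise p q []      = []
  homogenise p q (a ∷ f) = scale a (q ⊗^ length f) ⊕ (p ⊗ homogenise p q f)

  eval-homogenise : ∀ s {y} p q → FractionAt s p q y →
                    ∀ f → eval s q * eval s (homogenise p q f) ≈ eval s q ^ length f * eval y f
  eval-homogenise s {y} p q y≈p/q []      = trans (zeroʳ _) (sym (zeroʳ _))
  eval-homogenise s {y} p q y≈p/q (a ∷ f) = begin
    Q * eval s (scale a (q ⊗^ n) ⊕ (p ⊗ homogenise p q f))
      ≈⟨ *-congˡ (trans (eval-⊕ s (scale a (q ⊗^ n)) (p ⊗ homogenise p q f))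
                        (+-cong (trans (eval-scale s a (q ⊗^ n)) (*-congˡ (eval-⊗^ s q n))) (eval-⊗ s p _))) ⟩
    Q * (ι a * Q ^ n + eval s p * H)        ≈⟨ *-congˡ (+-congˡ (*-congʳ (sym y≈p/q))) ⟩
    Q * (ι a * Q ^ n + (y * Q) * H)
      ≈⟨ solve 5 (λ Q A Qn Y H → Q :* (A :* Qn :+ (Y :* Q) :* H) := A :* (Q :* Qn) :+ (Y :* Q) :* (Q :* H))
               refl Q (ι a) (Q ^ n) y H ⟩
    ι a * (Q * Q ^ n) + (y * Q) * (Q * H)   ≈⟨ +-congˡ (*-congˡ (eval-homogenise s p q y≈p/q f)) ⟩
    ι a * (Q * Q ^ n) + (y * Q) * (Q ^ n * eval y f)
      ≈⟨ solve 5 (λ Q A Qn Y F → A :* (Q :* Qn) :+ (Y :* Q) :* (Qn :* F) := (Q :* Qn) :* (A :+ Y :* F))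
               refl Q (ι a) (Q ^ n) y (eval y f) ⟩
    (Q * Q ^ n) * (ι a + y * eval y f)      ∎
    where
    open IntegerCoefficients K using (solve; _:=_; _:+_; _:*_)
    Q = eval s q
    n = length f
    H = eval s (homogenise p q f)

  pencil : Carrier → Poly → Poly → PK.Poly
  pencil r p q = map ι p PK.⊝ PK.scale r (map ι q)

  eval-pencil : ∀ s r p q → RK.eval s (pencil r p q) ≈ eval s p - r * eval s q
  eval-pencil s r p q = begin
    RK.eval s (pencil r p q)                                   ≈⟨ RK.eval-⊝ s (map ι p) (PK.scale r (map ι q)) ⟩
    RK.eval s (map ι p) - RK.eval s (PK.scale r (map ι q))     ≈⟨ +-congˡ (-‿cong (RK.eval-scale s r (map ι q))) ⟩
    RK.eval s (map ι p) - r * RK.eval s (map ι q)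
      ≡⟨ ≡.sym (≡.cong₂ (λ P Q → P - r * Q) (eval-map s p) (eval-map s q)) ⟩
    eval s p - r * eval s q                                    ∎

  pencil-IsZero⇒IsConstant : ∀ r p q → PK.IsZero (pencil r p q) → ¬ IsZero q → IsConstant r
  pencil-IsZero⇒IsConstant r p       []      _ q≉0 = ⊥-elim (q≉0 [])
  pencil-IsZero⇒IsConstant r []      (b ∷ q) (head≈0 ∷ tail≈0) q≉0
    with lowerExcludedMiddle (c ⊔ c′ ⊔ ℓ′) em {b k.≈ k.0#}
  ... | yes b≈0 = pencil-IsZero⇒IsConstant r [] q tail≈0 (q≉0 ∘ (b≈0 ∷_))
  ... | no  b≉0 = k.0# , trans (FK.*≈0⇒≈0 (ι-≉0 b≉0) ιb*r≈0) (sym 0#-homo)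
    where
    open RingProperties ring using (-‿involutive; -0#≈0#)
    ιb*r≈0 : ι b * r ≈ 0#
    ιb*r≈0 = trans (*-comm _ _) (trans (sym (-‿involutive _)) (trans (-‿cong head≈0) -0#≈0#))
  pencil-IsZero⇒IsConstant r (a ∷ p) (b ∷ q) (head≈0 ∷ tail≈0) q≉0
    with lowerExcludedMiddle (c ⊔ c′ ⊔ ℓ′) em {b k.≈ k.0#}
  ... | yes b≈0 = pencil-IsZero⇒IsConstant r p q tail≈0 (q≉0 ∘ (b≈0 ∷_))
  ... | no  b≉0 = a/b , FK.*-cancelʳ (ι-≉0 b≉0) (trans (sym (FK.x-y≈0⇒x≈y head≈0)) (sym ιa/b*ιb≈ιa))
    where
    a/b = Fk.quotient a b b≉0
    ιa/b*ιb≈ιa : ι a/b * ι b ≈ ι a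
    ιa/b*ιb≈ιa = trans (sym (*-homo a/b b)) (⟦⟧-cong (Fk.quotient-* a b b≉0))

  -- Write x = p(t)/q(t) with f(x) = 0. The homogenisation of f
  -- at p/q vanishes at t, hence identically, so p(s)/q(s) is a root of f whenever q(s) ≠ 0. Either
  -- some root r of f has p − r·q ≡ 0, forcing x = r ∈ k, or a point s among 1, t, t², … avoids the
  -- zeros of q and of every p − r·q, and then the root p(s)/q(s) of f can equal no r.
  module _ {x} (x-nonconstant : ¬ IsConstant x) {f} (f≉0 : ¬ IsZero f) (fx≈0 : eval x f ≈ 0#) where
    private
      p = proj₁ (fractions x)
      q = proj₁ (proj₂ (fractions x))
      qt≉0 : ¬ eval t q ≈ 0#
      qt≉0 = proj₁ (proj₂ (proj₂ (fractions x)))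
      x≈p/q : FractionAt t p q x
      x≈p/q = proj₂ (proj₂ (proj₂ (fractions x)))

      homogenise-IsZero : IsZero (homogenise p q f)
      homogenise-IsZero = transcendental (homogenise p q f) (FK.*≈0⇒≈0 qt≉0 (begin
        eval t q * eval t (homogenise p q f) ≈⟨ eval-homogenise t p q x≈p/q f ⟩
        eval t q ^ length f * eval x f       ≈⟨ *-congˡ fx≈0 ⟩
        eval t q ^ length f * 0#             ≈⟨ zeroʳ _ ⟩
        0#                                   ∎))

      quotient-root : ∀ s (qs≉0 : ¬ eval s q ≈ 0#) → eval (FK.quotient (eval s p) (eval s q) qs≉0) f ≈ 0#
      quotient-root s qs≉0 = FK.*≈0⇒≈0 (FK.^-≉0 (length f) qs≉0) (begin
        eval s q ^ length f * eval _ f         ≈⟨ sym (eval-homogenise s p q (fraction-quotient s p q qs≉0) f) ⟩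
        eval s q * eval s (homogenise p q f)   ≈⟨ *-congˡ (eval-IsZero s homogenise-IsZero) ⟩
        eval s q * 0#                          ≈⟨ zeroʳ _ ⟩
        0#                                     ∎)

      roots = RK.roots-finite (map ι f) (f≉0 ∘ IsZero-map⁻ f)
      C = proj₁ roots

      root∈C : ∀ y → eval y f ≈ 0# → Any (y ≈_) C
      root∈C y fy≈0 = proj₂ (proj₂ roots) y (≡.subst (_≈ 0#) (eval-map y f) fy≈0)

      vanishing-pencil-absurd : Any (λ r → PK.IsZero (pencil r p q)) C → ⊥
      vanishing-pencil-absurd vanishes = x-nonconstant (a , trans x≈r r≈ιa)
        where
        r = proj₁ (Any.satisfied vanishes)
        pencil≈0 = proj₂ (Any.satisfied vanishes)
        a = proj₁ (pencil-IsZero⇒IsConstant r p q pencil≈0 (eval-≉0⇒≉0 q qt≉0))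
        r≈ιa = proj₂ (pencil-IsZero⇒IsConstant r p q pencil≈0 (eval-≉0⇒≉0 q qt≉0))
        x≈r : x ≈ r
        x≈r = FK.*-cancelʳ qt≉0 (trans x≈p/q (FK.x-y≈0⇒x≈y
                (trans (sym (eval-pencil t r p q)) (RK.eval-IsZero t pencil≈0))))

      nonvanishing-pencils-absurd : All (λ r → ¬ PK.IsZero (pencil r p q)) C → ⊥
      nonvanishing-pencils-absurd nonvanishing = proj₁ avoidsPencil (begin
        RK.eval s (pencil r p q)   ≈⟨ eval-pencil s r p q ⟩
        eval s p - r * eval s q    ≈⟨ +-congˡ (-‿cong (*-congʳ (sym (proj₂ avoidsPencil)))) ⟩
        eval s p - y * eval s q    ≈⟨ FK.x≈y⇒x-y≈0 (sym (fraction-quotient s p q qs≉0)) ⟩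
        0#                         ∎)
        where
        polys = map ι q ∷ map (λ r → pencil r p q) C
        N = suc (sum (map length polys))
        powers : Fin N → Carrier
        powers i = t ^ toℕ i
        chosen = RK.avoidRoots polys ((eval-≉0⇒≉0 q qt≉0 ∘ IsZero-map⁻ q) ∷ Allₚ.map⁺ nonvanishing)
                   (ℕₚ.n<1+n _) powers (λ i j tⁱ≈tʲ → Finₚ.toℕ-injective (^-injective transcendental _ _ tⁱ≈tʲ))
        s = powers (proj₁ chosen)
        qs≉0 : ¬ eval s q ≈ 0#
        qs≉0 = All.head (proj₂ chosen) ∘ ≡.subst (_≈ 0#) (eval-map s q)
        y = FK.quotient (eval s p) (eval s q) qs≉0
        y∈C = root∈C y (quotient-root s qs≉0)
        r = Any.lookup y∈C
        avoidsPencil = All.lookupAny (Allₚ.map⁻ (All.tail (proj₂ chosen))) y∈C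

    nonconstant-root-absurd : ⊥
    nonconstant-root-absurd with lowerExcludedMiddle (c ⊔ ℓ) em {Any (λ r → PK.IsZero (pencil r p q)) C}
    ... | yes vanishes   = vanishing-pencil-absurd vanishes
    ... | no  ¬vanishes = nonvanishing-pencils-absurd (Allₚ.¬Any⇒All¬ C ¬vanishes)

  constant-or-transcendental : ∀ x → IsConstant x ⊎ Transcendental x
  constant-or-transcendental x with lowerExcludedMiddle (ℓ ⊔ c′) em {IsConstant x}
  ... | yes constant    = inj₁ constant
  ... | no  nonconstant = inj₂ λ f fx≈0 →
    decidable-stable (lowerExcludedMiddle (c′ ⊔ ℓ′) em) (λ f≉0 → nonconstant-root-absurd nonconstant f≉0 fx≈0)

  module SubstituteT {x} (x-transcendental : Transcendental x) where
    private
      numer : Carrier → Poly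
      numer z = proj₁ (fractions z)
      denom : Carrier → Poly
      denom z = proj₁ (proj₂ (fractions z))
      denom-t≉0 : ∀ z → ¬ eval t (denom z) ≈ 0#
      denom-t≉0 z = proj₁ (proj₂ (proj₂ (fractions z)))
      z≈numer/denom : ∀ z → FractionAt t (numer z) (denom z) z
      z≈numer/denom z = proj₂ (proj₂ (proj₂ (fractions z)))

      x-≉0 : ∀ Q → ¬ eval t Q ≈ 0# → ¬ eval x Q ≈ 0#
      x-≉0 Q Qt≉0 Qx≈0 = eval-≉0⇒≉0 Q Qt≉0 (x-transcendental Q Qx≈0)

    σ : Carrier → Carrier
    σ z = FK.quotient (eval x (numer z)) (eval x (denom z)) (x-≉0 (denom z) (denom-t≉0 z))

    σz≈numer/denom : ∀ z → FractionAt x (numer z) (denom z) (σ z)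
    σz≈numer/denom z = fraction-quotient x (numer z) (denom z) _

    σ-fraction : ∀ z w P Q → ¬ eval t Q ≈ 0# → FractionAt t P Q z → FractionAt x P Q w → σ z ≈ w
    σ-fraction z w P Q Qt≉0 z≈P/Q w≈P/Q =
      cross⇒fraction-≈ x (numer z) (denom z) P Q (σz≈numer/denom z) w≈P/Q
        (x-≉0 (denom z) (denom-t≉0 z)) (x-≉0 Q Qt≉0)
        (transfer transcendental x (numer z ⊗ Q) (P ⊗ denom z)
          (fraction-≈⇒cross t (numer z) (denom z) P Q (z≈numer/denom z) z≈P/Q refl))

    σ-cong : ∀ {z z′} → z ≈ z′ → σ z ≈ σ z′
    σ-cong {z} {z′} z≈z′ = σ-fraction z (σ z′) (numer z′) (denom z′) (denom-t≉0 z′)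
      (trans (*-congʳ z≈z′) (z≈numer/denom z′)) (σz≈numer/denom z′)

    σ-+ : ∀ z z′ → σ (z + z′) ≈ σ z + σ z′
    σ-+ z z′ = σ-fraction (z + z′) (σ z + σ z′) (numer z ⊗ denom z′ ⊕ numer z′ ⊗ denom z) (denom z ⊗ denom z′)
      (eval-⊗-≉0 t (denom z) (denom z′) (denom-t≉0 z) (denom-t≉0 z′))
      (fraction-+ t (numer z) (denom z) (numer z′) (denom z′) (z≈numer/denom z) (z≈numer/denom z′))
      (fraction-+ x (numer z) (denom z) (numer z′) (denom z′) (σz≈numer/denom z) (σz≈numer/denom z′))

    σ-* : ∀ z z′ → σ (z * z′) ≈ σ z * σ z′
    σ-* z z′ = σ-fraction (z * z′) (σ z * σ z′) (numer z ⊗ numer z′) (denom z ⊗ denom z′)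
      (eval-⊗-≉0 t (denom z) (denom z′) (denom-t≉0 z) (denom-t≉0 z′))
      (fraction-* t (numer z) (denom z) (numer z′) (denom z′) (z≈numer/denom z) (z≈numer/denom z′))
      (fraction-* x (numer z) (denom z) (numer z′) (denom z′) (σz≈numer/denom z) (σz≈numer/denom z′))

    σ-neg : ∀ z → σ (- z) ≈ - σ z
    σ-neg z = σ-fraction (- z) (- σ z) (⊖ numer z) (denom z) (denom-t≉0 z)
      (fraction-neg t (numer z) (denom z) (z≈numer/denom z)) (fraction-neg x (numer z) (denom z) (σz≈numer/denom z))

    σ-ι : ∀ a → σ (ι a) ≈ ι a
    σ-ι a = σ-fraction (ι a) (ι a) (constant a) (constant k.1#) (eval-1-≉0 t)
      (fraction-constant t a) (fraction-constant x a)

    σ-t : σ t ≈ x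
    σ-t = σ-fraction t x X (constant k.1#) (eval-1-≉0 t) (fraction-X t) (fraction-X x)

    σ-injective : ∀ {z z′} → σ z ≈ σ z′ → z ≈ z′
    σ-injective {z} {z′} σz≈σz′ =
      cross⇒fraction-≈ t (numer z) (denom z) (numer z′) (denom z′) (z≈numer/denom z) (z≈numer/denom z′)
        (denom-t≉0 z) (denom-t≉0 z′)
        (transfer x-transcendental t (numer z ⊗ denom z′) (numer z′ ⊗ denom z)
          (fraction-≈⇒cross x (numer z) (denom z) (numer z′) (denom z′)
            (σz≈numer/denom z) (σz≈numer/denom z′) σz≈σz′))

    σ-mono : IsRingMonomorphism K K σ
    σ-mono = record
      { isRingHomomorphism = record
        { isSemiringHomomorphism = record
          { isNearSemiringHomomorphism = record
            { +-isMonoidHomomorphism = record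
              { isMagmaHomomorphism = record { isRelHomomorphism = record { cong = σ-cong } ; homo = σ-+ }
              ; ε-homo = trans (σ-cong (sym 0#-homo)) (trans (σ-ι k.0#) 0#-homo) }
            ; *-homo = σ-* }
          ; 1#-homo = trans (σ-cong (sym 1#-homo)) (trans (σ-ι k.1#) 1#-homo) }
        ; -‿homo = σ-neg }
      ; injective = σ-injective }

module Specialisation {c ℓ c′ ℓ′} (k : CommutativeRing c ℓ) (K : CommutativeRing c′ ℓ′)
  {ι : CommutativeRing.Carrier k → CommutativeRing.Carrier K} {t : CommutativeRing.Carrier K}
  (rff : IsRationalFunctionField k K ι t) (k-field : IsField k)
  (em : ExcludedMiddle (c ⊔ ℓ ⊔ c′ ⊔ ℓ′)) (k-infinite : HasCard k ∞) where

  open IsRationalFunctionField rff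
  open RationalFunctionField k K rff k-field em using (eval-≉0⇒≉0)
  private
    module k = CommutativeRing k
    module Fk = FieldProperties k k-field
    module Rk = PolynomialRoots k k-field (lowerExcludedMiddle (c′ ⊔ ℓ′) em)
    module Frk = Fractions k k k-field (Identity.isRingHomomorphism k.rawRing k.refl)
    module SemK = Semantics K
    module Semk = Semantics k
  open CommutativeRing K hiding (zero)
  open Polynomial k
  open Evaluation k K ι-hom
  open Fractions k K field-K ι-hom

  private
    emk : ExcludedMiddle (c ⊔ ℓ)
    emk = lowerExcludedMiddle (c′ ⊔ ℓ′) em

  -- If v enumerates all of k we get a bijection Fin N ≅ k, contradicting infinity.
  distinct-elements : ∀ N → ∃ λ (v : Fin N → k.Carrier) → ∀ i j → v i k.≈ v j → i ≡ j
  distinct-elements zero = (λ ()) , λ ()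
  distinct-elements (suc N) with distinct-elements N
  ... | v , v-injective with emk {∃ λ a → ∀ i → ¬ a k.≈ v i}
  ...   | yes (a , a∉v) = (a ∷ᵥ v) , extended-injective
    where
    extended-injective : ∀ i j → (a ∷ᵥ v) i k.≈ (a ∷ᵥ v) j → i ≡ j
    extended-injective zero    zero    _   = ≡.refl
    extended-injective zero    (suc j) a≈v = ⊥-elim (a∉v j a≈v)
    extended-injective (suc i) zero    v≈a = ⊥-elim (a∉v i (k.sym v≈a))
    extended-injective (suc i) (suc j) v≈v = ≡.cong suc (v-injective i j v≈v)
  ...   | no ¬fresh = ⊥-elim (k-infinite N enumeration)
    where
    index : ∀ a → ∃ λ i → a k.≈ v i
    index a with emk {Lift c (∃ λ i → a k.≈ v i)}
    ... | yes (lift found) = found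
    ... | no  missing      = ⊥-elim (¬fresh (a , λ i a≈vi → missing (lift (i , a≈vi))))
    enumeration : Inverse (≡.setoid (Fin N)) k.setoid
    enumeration = record
      { to        = v
      ; from      = proj₁ ∘ index
      ; to-cong   = λ { ≡.refl → k.refl }
      ; from-cong = λ {a} {b} a≈b → v-injective _ _ (k.trans (k.sym (proj₂ (index a))) (k.trans a≈b (proj₂ (index b))))
      ; inverse   = (λ { {a} ≡.refl → k.sym (proj₂ (index a)) })
                  , (λ {a} {b} b≈va → v-injective _ _ (k.trans (k.sym (proj₂ (index b))) b≈va))
      }

  Avoids : k.Carrier → List Poly → Set (c ⊔ ℓ)
  Avoids a B = All (λ p → ¬ Rk.eval a p k.≈ k.0#) B

  NonZero : List Poly → Set (c ⊔ ℓ)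
  NonZero B = All (¬_ ∘ IsZero) B

  module _ {n} (P Q : Fin n → Poly) where
    specialise : ∀ a → (∀ j → ¬ Rk.eval a (Q j) k.≈ k.0#) → Vector k.Carrier n
    specialise a Qa≉0 j = Fk.quotient (Rk.eval a (P j)) (Rk.eval a (Q j)) (Qa≉0 j)

    module _ (ρ : Vector Carrier n) (Qt≉0 : ∀ j → ¬ eval t (Q j) ≈ 0#) (ρ≈P/Q : ∀ j → FractionAt t (P j) (Q j) (ρ j)) where
      open TermFractions k P Q using (equationPoly)

      -- B collects the nonzero equation polynomials; at points avoiding their zeros no atom changes truth value.
      satQF-specialise : ∀ φ → ∃ λ B → NonZero B ×
        (∀ a Qa≉0 → Avoids a B → SemK.satQF (lift tt) ρ φ ⇔ Semk.satQF (lift tt) (specialise a Qa≉0) φ)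
      satQF-specialise (u ==' v) with emk {IsZero (equationPoly u v)}
      ... | yes eq≈0 = [] , [] , λ a Qa≉0 _ → mk⇔
        (λ _ → from (Frk.equation⇔equationPoly P Q a (specialise a Qa≉0) Qa≉0 (λ j → Fk.quotient-* _ _ _) u v)
                    (Rk.eval-IsZero a eq≈0))
        (λ _ → from (equation⇔equationPoly P Q t ρ Qt≉0 ρ≈P/Q u v) (eval-IsZero t eq≈0))
      ... | no  eq≉0 = (equationPoly u v ∷ []) , (eq≉0 ∷ []) , λ a Qa≉0 avoids → mk⇔
        (λ u≈v → ⊥-elim (eq≉0 (transcendental _ (to (equation⇔equationPoly P Q t ρ Qt≉0 ρ≈P/Q u v) u≈v))))
        (λ u≈v → ⊥-elim (All.head avoids
                   (to (Frk.equation⇔equationPoly P Q a (specialise a Qa≉0) Qa≉0 (λ j → Fk.quotient-* _ _ _) u v) u≈v)))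
      satQF-specialise ⊤' = [] , [] , λ _ _ _ → mk⇔ (λ _ → lift tt) (λ _ → lift tt)
      satQF-specialise ⊥' = [] , [] , λ _ _ _ → mk⇔ (λ ()) (λ ())
      satQF-specialise (¬' φ) with satQF-specialise φ
      ... | B , B≉0 , spec = B , B≉0 , λ a Qa≉0 avoids →
        mk⇔ (λ ¬sat sat → ¬sat (from (spec a Qa≉0 avoids) sat)) (λ ¬sat sat → ¬sat (to (spec a Qa≉0 avoids) sat))
      satQF-specialise (φ ∧' ψ) with satQF-specialise φ | satQF-specialise ψ
      ... | B , B≉0 , specφ | D , D≉0 , specψ = B ++ D , Allₚ.++⁺ B≉0 D≉0 , λ a Qa≉0 avoids →
        specφ a Qa≉0 (Allₚ.++⁻ˡ B avoids) ×-⇔ specψ a Qa≉0 (Allₚ.++⁻ʳ B avoids)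
      satQF-specialise (φ ∨' ψ) with satQF-specialise φ | satQF-specialise ψ
      ... | B , B≉0 , specφ | D , D≉0 , specψ = B ++ D , Allₚ.++⁺ B≉0 D≉0 , λ a Qa≉0 avoids →
        specφ a Qa≉0 (Allₚ.++⁻ˡ B avoids) ⊎-⇔ specψ a Qa≉0 (Allₚ.++⁻ʳ B avoids)

  satEx-specialise : ∀ {n} (P Q : Fin n → Poly) (ρ : Vector Carrier n) (Qt≉0 : ∀ j → ¬ eval t (Q j) ≈ 0#) →
    (∀ j → FractionAt t (P j) (Q j) (ρ j)) → ∀ φ → SemK.satEx (lift tt) ρ φ →
    ∃ λ B → NonZero B × (∀ a Qa≉0 → Avoids a B → Semk.satEx (lift tt) (specialise P Q a Qa≉0) φ)
  satEx-specialise P Q ρ Qt≉0 ρ≈P/Q (qf φ) (lift sat) with satQF-specialise P Q ρ Qt≉0 ρ≈P/Q φ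
  ... | B , B≉0 , spec = B , B≉0 , λ a Qa≉0 avoids → lift (to (spec a Qa≉0 avoids) sat)
  satEx-specialise P Q ρ Qt≉0 ρ≈P/Q (φ ∧ₑ ψ) (satφ , satψ)
    with satEx-specialise P Q ρ Qt≉0 ρ≈P/Q φ satφ | satEx-specialise P Q ρ Qt≉0 ρ≈P/Q ψ satψ
  ... | B , B≉0 , specφ | D , D≉0 , specψ = B ++ D , Allₚ.++⁺ B≉0 D≉0 , λ a Qa≉0 avoids →
    specφ a Qa≉0 (Allₚ.++⁻ˡ B avoids) , specψ a Qa≉0 (Allₚ.++⁻ʳ B avoids)
  satEx-specialise P Q ρ Qt≉0 ρ≈P/Q (φ ∨ₑ ψ) (inj₁ sat) with satEx-specialise P Q ρ Qt≉0 ρ≈P/Q φ sat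
  ... | B , B≉0 , spec = B , B≉0 , λ a Qa≉0 avoids → inj₁ (spec a Qa≉0 avoids)
  satEx-specialise P Q ρ Qt≉0 ρ≈P/Q (φ ∨ₑ ψ) (inj₂ sat) with satEx-specialise P Q ρ Qt≉0 ρ≈P/Q ψ sat
  ... | B , B≉0 , spec = B , B≉0 , λ a Qa≉0 avoids → inj₂ (spec a Qa≉0 avoids)
  satEx-specialise P Q ρ Qt≉0 ρ≈P/Q (∃ₑ φ) (y , sat)
    with satEx-specialise (p ∷ᵥ P) (q ∷ᵥ Q) (y ∷ᵥ ρ) Qt≉0′ ρ≈P/Q′ φ sat
    where
    p = proj₁ (fractions y)
    q = proj₁ (proj₂ (fractions y))
    Qt≉0′ : ∀ j → ¬ eval t ((q ∷ᵥ Q) j) ≈ 0#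
    Qt≉0′ zero    = proj₁ (proj₂ (proj₂ (fractions y)))
    Qt≉0′ (suc j) = Qt≉0 j
    ρ≈P/Q′ : ∀ j → FractionAt t ((p ∷ᵥ P) j) ((q ∷ᵥ Q) j) ((y ∷ᵥ ρ) j)
    ρ≈P/Q′ zero    = proj₂ (proj₂ (proj₂ (fractions y)))
    ρ≈P/Q′ (suc j) = ρ≈P/Q j
  ... | B , B≉0 , spec =
    (q ∷ B) , (eval-≉0⇒≉0 q (proj₁ (proj₂ (proj₂ (fractions y)))) ∷ B≉0) , witness
    where
    p = proj₁ (fractions y)
    q = proj₁ (proj₂ (fractions y))
    witness : ∀ a Qa≉0 → Avoids a (q ∷ B) → Semk.satEx (lift tt) (specialise P Q a Qa≉0) (∃ₑ φ)
    witness a Qa≉0 (qa≉0 ∷ avoids) = w , satEx-cong k (specialise (p ∷ᵥ P) (q ∷ᵥ Q) a Qa≉0′) (w ∷ᵥ specialise P Q a Qa≉0)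
                                          pointwise φ (spec a Qa≉0′ avoids)
      where
      Qa≉0′ : ∀ j → ¬ Rk.eval a ((q ∷ᵥ Q) j) k.≈ k.0#
      Qa≉0′ zero    = qa≉0
      Qa≉0′ (suc j) = Qa≉0 j
      w = specialise (p ∷ᵥ P) (q ∷ᵥ Q) a Qa≉0′ zero
      pointwise : ∀ j → (w ∷ᵥ specialise P Q a Qa≉0) j k.≈ specialise (p ∷ᵥ P) (q ∷ᵥ Q) a Qa≉0′ j
      pointwise zero    = k.refl
      pointwise (suc j) = k.refl

  satEx-descend : ∀ {n} (b : Vector k.Carrier n) φ → SemK.satEx (lift tt) (ι ∘ b) φ → Semk.satEx (lift tt) b φ
  satEx-descend {n} b φ sat = satEx-cong k (specialise P Q a Qa≉0) b b≈specialised φ (spec a Qa≉0 avoids)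
    where
    P : Fin n → Poly
    P j = constant (b j)
    Q : Fin n → Poly
    Q j = constant k.1#
    specialised = satEx-specialise P Q (ι ∘ b) (λ _ → eval-1-≉0 t) (λ j → fraction-constant t (b j)) φ sat
    B = proj₁ specialised
    spec = proj₂ (proj₂ specialised)
    points = distinct-elements (suc (sum (map length B)))
    chosen = Rk.avoidRoots B (proj₁ (proj₂ specialised)) (ℕₚ.n<1+n _) (proj₁ points) (proj₂ points)
    a = proj₁ points (proj₁ chosen)
    avoids = proj₂ chosen
    Qa≉0 : ∀ j → ¬ Rk.eval a (Q j) k.≈ k.0#
    Qa≉0 j = Frk.eval-1-≉0 a
    b≈specialised : ∀ j → b j k.≈ specialise P Q a Qa≉0 j
    b≈specialised j = k.sym (k.trans (k.sym (k.*-identityʳ _)) (k.trans (k.*-congˡ (k.sym (Rk.eval-1 a)))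
                        (k.trans (Fk.quotient-* _ _ (Qa≉0 j)) (Rk.eval-constant a (b j)))))

-- The translation τ

t/x₀ : ∀ {n} → Substitution LringT (suc n) n
t/x₀ zero    = tconst
t/x₀ (suc j) = var j

atT : ∀ {n} → FormEx Lring (suc n) → FormEx LringT n
atT = substEx t/x₀

FreeEx-atT : ∀ {n} i (θ : FormEx Lring (suc n)) → FreeEx i (atT θ) ⇔ FreeEx (suc i) θ
FreeEx-atT i θ = ⇔.trans (FreeEx-substEx t/x₀ i θ)
  (mk⇔ (λ { (zero , _ , ()) ; (suc j , free , ≡.refl) → free }) (λ free → suc i , free , ≡.refl))

-- In k(t) with #k = m, pairwise distinct w₁ … wₘ closed under multiplication are exactly the
-- elements of k, so ∀ᵐ θ, which asserts θ(wᵢ) for such wᵢ, expresses "θ holds on k".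
module ForallFinite (m : ℕ) {n : ℕ} where
  w : Fin m → Term LringT (m ℕ.+ n)
  w i = var (i ↑ˡ n)

  distinctAt : Fin m → Fin m → QF LringT (m ℕ.+ n)
  distinctAt i j with i Finₚ.≟ j
  ... | yes _ = ⊤'
  ... | no  _ = ¬' (w i ==' w j)

  distinct : QF LringT (m ℕ.+ n)
  distinct = ⋀ m λ i → ⋀ m λ j → distinctAt i j

  productAt : Fin m → Fin m → Fin m → QF LringT (m ℕ.+ n)
  productAt i j l = (w i *' w j) ==' w l

  closed : QF LringT (m ℕ.+ n)
  closed = ⋀ m λ i → ⋀ m λ j → ⋁ m λ l → productAt i j l

  w/x₀ : Fin m → Substitution LringT (suc n) (m ℕ.+ n)
  w/x₀ i zero    = w i
  w/x₀ i (suc j) = var (m ↑ʳ j)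

  ∀ᵐ : FormEx Lring (suc n) → FormEx LringT n
  ∀ᵐ θ = ∃ⁿ m (qf (distinct ∧' closed) ∧ₑ ⋀ₑ m λ i → substEx (w/x₀ i) θ)

  private
    ↑ˡ≢↑ʳ : ∀ {m′} (i : Fin m′) j → i ↑ˡ n ≢ m′ ↑ʳ j
    ↑ˡ≢↑ʳ zero    j ()
    ↑ˡ≢↑ʳ (suc i) j eq = ↑ˡ≢↑ʳ i j (Finₚ.suc-injective eq)

    w-closed : ∀ i l → ¬ FreeT (m ↑ʳ i) (w l)
    w-closed i l eq = ↑ˡ≢↑ʳ l i (≡.sym eq)

    distinctAt-closed : ∀ i a b → ¬ FreeQF (m ↑ʳ i) (distinctAt a b)
    distinctAt-closed i a b free with a Finₚ.≟ b
    distinctAt-closed i a b ()          | yes _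
    distinctAt-closed i a b (inj₁ free) | no  _ = w-closed i a free
    distinctAt-closed i a b (inj₂ free) | no  _ = w-closed i b free

    productAt-closed : ∀ i a b l → ¬ FreeQF (m ↑ʳ i) (productAt a b l)
    productAt-closed i a b l (inj₁ (inj₁ free)) = w-closed i a free
    productAt-closed i a b l (inj₁ (inj₂ free)) = w-closed i b free
    productAt-closed i a b l (inj₂ free)        = w-closed i l free

    FreeEx-w/x₀ : ∀ i a θ → FreeEx (m ↑ʳ i) (substEx (w/x₀ a) θ) → FreeEx (suc i) θ
    FreeEx-w/x₀ i a θ free with to (FreeEx-substEx (w/x₀ a) (m ↑ʳ i) θ) free
    ... | zero  , _     , freeT = ⊥-elim (w-closed i a freeT)
    ... | suc j , freeθ , freeT = ≡.subst (λ j → FreeEx (suc j) θ) (≡.sym (Finₚ.↑ʳ-injective m i j freeT)) freeθ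

  FreeEx-∀ᵐ : ∀ i θ → FreeEx i (∀ᵐ θ) → FreeEx (suc i) θ
  FreeEx-∀ᵐ i θ free with FreeEx-∃ⁿ m (qf (distinct ∧' closed) ∧ₑ ⋀ₑ m λ a → substEx (w/x₀ a) θ) i free
  ... | inj₁ (inj₁ free′) =
    let (a , free″) = FreeQF-⋀ m _ _ free′ ; (b , free‴) = FreeQF-⋀ m _ _ free″
    in ⊥-elim (distinctAt-closed i a b free‴)
  ... | inj₁ (inj₂ free′) =
    let (a , free″) = FreeQF-⋀ m _ _ free′ ; (b , free‴) = FreeQF-⋀ m _ _ free″ ; (l , free⁗) = FreeQF-⋁ m _ _ free‴
    in ⊥-elim (productAt-closed i a b l free⁗)
  ... | inj₂ free′ = let (a , free″) = FreeEx-⋀ₑ m _ _ free′ in FreeEx-w/x₀ i a θ free″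

τ : ℕ∞ → ∀ {n} → FormA1E Lring n → FormEx LringT n × FormA1E Lring n
τ q       (ex θ) = substEx var θ , ex (tautologyEx θ)
τ ∞       (∀ₐ θ) = atT θ , ∀ₐ θ
τ (fin m) (∀ₐ θ) = atT θ ∧ₑ ForallFinite.∀ᵐ m θ , ∀ₐ (tautologyEx θ)

τ-vars : ∀ q {n} (φ : FormA1E Lring n) i →
         (FreeEx i (proj₁ (τ q φ)) ⇔ FreeA i φ) × (FreeA i (proj₂ (τ q φ)) ⇔ FreeA i φ)
τ-vars q       (ex θ) i = FreeEx-substEx-var i θ , FreeEx-tautologyEx i θ
τ-vars ∞       (∀ₐ θ) i = FreeEx-atT i θ , ⇔.refl
τ-vars (fin m) (∀ₐ θ) i =
  mk⇔ [ to (FreeEx-atT i θ) , ForallFinite.FreeEx-∀ᵐ m i θ ]′ (inj₁ ∘ from (FreeEx-atT i θ)) ,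
  FreeEx-tautologyEx (suc i) θ

module ForallFiniteSemantics {c ℓ} (R : CommutativeRing c ℓ) (m : ℕ) {n : ℕ}
                             (t : CommutativeRing.Carrier R) (ρ : Vector (CommutativeRing.Carrier R) n) where
  open CommutativeRing R hiding (zero)
  open Semantics R
  open ForallFinite m {n}
  open SubstitutionLemma R using (satEx-substEx)
  open ConnectiveSemantics R

  module _ (w : Vector Carrier m) where
    private
      ρw = prepend w ρ
      ρw≈w : ∀ i → ρw (i ↑ˡ n) ≈ w i
      ρw≈w i = reflexive (prepend-↑ˡ w ρ i)

    satQF-distinctAt : ∀ i j → satQF t ρw (distinctAt i j) ⇔ (w i ≈ w j → i ≡ j)
    satQF-distinctAt i j with i Finₚ.≟ j
    ... | yes i≡j = mk⇔ (λ _ _ → i≡j) (λ _ → lift tt)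
    ... | no  i≢j = mk⇔ (λ wi≉wj wi≈wj → ⊥-elim (wi≉wj (trans (ρw≈w i) (trans wi≈wj (sym (ρw≈w j))))))
                        (λ inj ρwi≈ρwj → i≢j (inj (trans (sym (ρw≈w i)) (trans ρwi≈ρwj (ρw≈w j)))))

    satQF-distinct : satQF t ρw distinct ⇔ (∀ i j → w i ≈ w j → i ≡ j)
    satQF-distinct = mk⇔
      (λ sat i j → to (satQF-distinctAt i j) (to (satQF-⋀ t ρw m _) (to (satQF-⋀ t ρw m _) sat i) j))
      (λ inj → from (satQF-⋀ t ρw m _) λ i → from (satQF-⋀ t ρw m _) λ j → from (satQF-distinctAt i j) (inj i j))

    satQF-productAt : ∀ i j l → satQF t ρw (productAt i j l) ⇔ (w i * w j ≈ w l)
    satQF-productAt i j l = mk⇔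
      (λ sat → trans (*-cong (sym (ρw≈w i)) (sym (ρw≈w j))) (trans sat (ρw≈w l)))
      (λ eq → trans (*-cong (ρw≈w i) (ρw≈w j)) (trans eq (sym (ρw≈w l))))

    satQF-closed : satQF t ρw closed ⇔ (∀ i j → ∃ λ l → w i * w j ≈ w l)
    satQF-closed = mk⇔
      (λ sat i j → let (l , sat′) = to (satQF-⋁ t ρw m _) (to (satQF-⋀ t ρw m _) (to (satQF-⋀ t ρw m _) sat i) j)
                   in l , to (satQF-productAt i j l) sat′)
      (λ cl → from (satQF-⋀ t ρw m _) λ i → from (satQF-⋀ t ρw m _) λ j →
                from (satQF-⋁ t ρw m _) (proj₁ (cl i j) , from (satQF-productAt i j _) (proj₂ (cl i j))))

    satEx-w/x₀ : ∀ θ i → satEx (lift tt) (w i ∷ᵥ ρ) θ ⇔ satEx t ρw (substEx (w/x₀ i) θ)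
    satEx-w/x₀ θ i = satEx-substEx t ρw (w/x₀ i) (w i ∷ᵥ ρ) pointwise θ
      where
      pointwise : ∀ j → (w i ∷ᵥ ρ) j ≈ evalT t ρw (w/x₀ i j)
      pointwise zero    = sym (ρw≈w i)
      pointwise (suc j) = reflexive (≡.sym (prepend-↑ʳ w ρ j))

  satEx-∀ᵐ : ∀ θ → satEx t ρ (∀ᵐ θ) ⇔
             (∃ λ w → (∀ i j → w i ≈ w j → i ≡ j) × (∀ i j → ∃ λ l → w i * w j ≈ w l) × (∀ i → satEx (lift tt) (w i ∷ᵥ ρ) θ))
  satEx-∀ᵐ θ = ⇔.trans (satEx-∃ⁿ t ρ m _) (mk⇔
    (λ { (w , lift (D , M) , T) → w , to (satQF-distinct w) D , to (satQF-closed w) M ,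
                                   λ i → from (satEx-w/x₀ w θ i) (to (satEx-⋀ₑ t (prepend w ρ) m _) T i) })
    (λ { (w , D , M , T) → w , lift (from (satQF-distinct w) D , from (satQF-closed w) M) ,
                           from (satEx-⋀ₑ t (prepend w ρ) m _) (λ i → to (satEx-w/x₀ w θ i) (T i)) }))

module Transfer {c ℓ c′ ℓ′} (k : CommutativeRing c ℓ) (K : CommutativeRing c′ ℓ′)
  {ι : CommutativeRing.Carrier k → CommutativeRing.Carrier K} {t : CommutativeRing.Carrier K}
  (rff : IsRationalFunctionField k K ι t) (k-field : IsField k)
  (em : ExcludedMiddle (c ⊔ ℓ ⊔ c′ ⊔ ℓ′)) where

  open RationalFunctionField k K rff k-field em
  private
    module k = CommutativeRing k
    module SemK = Semantics K
    module Semk = Semantics k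
  open CommutativeRing K hiding (zero)
  open RingMorphisms.IsRingHomomorphism (IsRationalFunctionField.ι-hom rff)
  open import Algebra.Definitions.RawSemiring (RawRing.rawSemiring rawRing) using (_^_)

  satEx-atT : ∀ {n} (ρ : Vector Carrier n) θ → SemK.satEx (lift tt) (t ∷ᵥ ρ) θ ⇔ SemK.satEx t ρ (atT θ)
  satEx-atT ρ = SubstitutionLemma.satEx-substEx K t ρ t/x₀ (t ∷ᵥ ρ) λ { zero → refl ; (suc j) → refl }

  ∀-from-t-and-constants : ∀ {n} (a : Vector k.Carrier n) θ → SemK.satEx (lift tt) (t ∷ᵥ ι ∘ a) θ →
                           (∀ b → SemK.satEx (lift tt) (ι b ∷ᵥ ι ∘ a) θ) → ∀ y → SemK.satEx (lift tt) (y ∷ᵥ ι ∘ a) θ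
  ∀-from-t-and-constants a θ sat-t sat-constant y with constant-or-transcendental y
  ... | inj₁ (b , y≈ιb) = satEx-cong K (ι b ∷ᵥ ι ∘ a) (y ∷ᵥ ι ∘ a) (λ { zero → y≈ιb ; (suc j) → refl }) θ (sat-constant b)
  ... | inj₂ y-transcendental = Preservation.satEx-homo σ-mono (t ∷ᵥ ι ∘ a) (y ∷ᵥ ι ∘ a)
          (λ { zero → sym σ-t ; (suc j) → sym (σ-ι (a j)) }) θ sat-t
    where open SubstituteT y-transcendental

  forall-infinite : HasCard k ∞ → ∀ {n} (a : Vector k.Carrier n) θ →
                    (∀ y → SemK.satEx (lift tt) (y ∷ᵥ ι ∘ a) θ) ⇔
                    (SemK.satEx t (ι ∘ a) (atT θ) × (∀ b → Semk.satEx (lift tt) (b ∷ᵥ a) θ))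
  forall-infinite k-infinite a θ = mk⇔
    (λ sat → to (satEx-atT (ι ∘ a) θ) (sat t) , λ b → satEx-descend (b ∷ᵥ a) θ
               (satEx-cong K (ι b ∷ᵥ ι ∘ a) (ι ∘ (b ∷ᵥ a)) (λ { zero → refl ; (suc j) → refl }) θ (sat (ι b))))
    (λ { (sat-t , sat-k) → ∀-from-t-and-constants a θ (from (satEx-atT (ι ∘ a) θ) sat-t) λ b →
           Preservation.satEx-homo ι-mono (b ∷ᵥ a) (ι b ∷ᵥ ι ∘ a) (λ { zero → refl ; (suc j) → refl }) θ (sat-k b) })
    where open Specialisation k K rff k-field em k-infinite using (satEx-descend)

  multiplicatively-closed⇒constant : ∀ {m} (w : Vector Carrier m) → (∀ i j → ∃ λ l → w i * w j ≈ w l) →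
                                     ∀ i → IsConstant (w i)
  multiplicatively-closed⇒constant {m} w closed i with constant-or-transcendental (w i)
  ... | inj₁ constant          = constant
  ... | inj₂ wi-transcendental = ⊥-elim (Finₚ.<⇒≢ a<b (Finₚ.toℕ-injective (ℕₚ.suc-injective
          (^-injective wi-transcendental (suc (toℕ a)) (suc (toℕ b))
            (trans (sym (power-≈ (toℕ a))) (trans (reflexive (≡.cong w powerᵃ≡powerᵇ)) (power-≈ (toℕ b))))))))
    where
    power : ℕ → Fin m
    power zero    = i
    power (suc r) = proj₁ (closed i (power r))
    power-≈ : ∀ r → w (power r) ≈ w i ^ suc r
    power-≈ zero    = sym (*-identityʳ _)
    power-≈ (suc r) = trans (sym (proj₂ (closed i (power r)))) (*-congˡ (power-≈ r))
    collision = Finₚ.pigeonhole (ℕₚ.n<1+n m) (power ∘ toℕ)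
    a = proj₁ collision
    b = proj₁ (proj₂ collision)
    a<b = proj₁ (proj₂ (proj₂ collision))
    powerᵃ≡powerᵇ = proj₂ (proj₂ (proj₂ collision))

  private
    from-injective : ∀ {m} (card : HasCard k (fin m)) {x y} → Inverse.from card x ≡ Inverse.from card y → x k.≈ y
    from-injective card eq = k.trans (k.sym (Inverse.inverseˡ card ≡.refl))
                               (k.trans (k.reflexive (≡.cong (Inverse.to card) eq)) (Inverse.inverseˡ card ≡.refl))

  -- Pigeonhole: a constant missing from m distinct constants would give m + 1 distinct elements of k.
  distinct-constants-exhaust : ∀ {m} → HasCard k (fin m) → (w : Vector Carrier m) → (∀ i j → w i ≈ w j → i ≡ j) →
                               (∀ i → IsConstant (w i)) → ∀ b → ∃ λ i → w i ≈ ι b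
  distinct-constants-exhaust {m} card w w-injective w-constant b
    with lowerExcludedMiddle (c ⊔ ℓ ⊔ c′) em {∃ λ i → w i ≈ ι b}
  ... | yes found = found
  ... | no  missing with Finₚ.pigeonhole (ℕₚ.n<1+n m) indices
    where
    indices : Fin (suc m) → Fin m
    indices zero    = Inverse.from card b
    indices (suc i) = Inverse.from card (proj₁ (w-constant i))
  ... | zero  , zero  , ()      , _
  ... | suc _ , zero  , ()      , _
  ... | zero  , suc j , _       , eq =
    ⊥-elim (missing (j , trans (proj₂ (w-constant j)) (⟦⟧-cong (k.sym (from-injective card eq)))))
  ... | suc i , suc j , s≤s i<j , eq = ⊥-elim (Finₚ.<⇒≢ i<j (w-injective i j
          (trans (proj₂ (w-constant i)) (trans (⟦⟧-cong (from-injective card eq)) (sym (proj₂ (w-constant j)))))))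

  forall-finite : ∀ {m} → HasCard k (fin m) → ∀ {n} (a : Vector k.Carrier n) θ →
                  (∀ y → SemK.satEx (lift tt) (y ∷ᵥ ι ∘ a) θ) ⇔ SemK.satEx t (ι ∘ a) (atT θ ∧ₑ ForallFinite.∀ᵐ m θ)
  forall-finite {m} card a θ = mk⇔
    (λ sat → to (satEx-atT (ι ∘ a) θ) (sat t) ,
             from (satEx-∀ᵐ θ) (ι ∘ enumerate , enumeration-injective , enumeration-closed , sat ∘ ι ∘ enumerate))
    (λ { (sat-t , sat-∀ᵐ) → let (w , w-injective , w-closed , sat-w) = to (satEx-∀ᵐ θ) sat-∀ᵐ in
         ∀-from-t-and-constants a θ (from (satEx-atT (ι ∘ a) θ) sat-t) λ b →
           let (i , wi≈ιb) = distinct-constants-exhaust card w w-injective (multiplicatively-closed⇒constant w w-closed) b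
           in satEx-cong K (w i ∷ᵥ ι ∘ a) (ι b ∷ᵥ ι ∘ a) (λ { zero → sym wi≈ιb ; (suc j) → refl }) θ (sat-w i) })
    where
    open ForallFiniteSemantics K m t (ι ∘ a) using (satEx-∀ᵐ)
    open Inverse card using () renaming (to to enumerate; from to index)
    enumeration-injective : ∀ i j → ι (enumerate i) ≈ ι (enumerate j) → i ≡ j
    enumeration-injective i j = Injection.injective (Inverse⇒Injection card) ∘ ι-injective
    enumeration-closed : ∀ i j → ∃ λ l → ι (enumerate i) * ι (enumerate j) ≈ ι (enumerate l)
    enumeration-closed i j = index (enumerate i k.* enumerate j) ,
      trans (sym (*-homo _ _)) (⟦⟧-cong (k.sym (Inverse.inverseˡ card ≡.refl)))

τ-defines : ∀ q {c ℓ c′ ℓ′} → ExcludedMiddle (c ⊔ ℓ ⊔ c′ ⊔ ℓ′) →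
            (k : CommutativeRing c ℓ) → IsField k → HasCard k q →
            (K : CommutativeRing c′ ℓ′) (ι : CommutativeRing.Carrier k → CommutativeRing.Carrier K)
            (t : CommutativeRing.Carrier K) → IsRationalFunctionField k K ι t →
            ∀ {n} (φ : FormA1E Lring n) (a : Vector (CommutativeRing.Carrier k) n) →
            (K ⊨ₐ φ [ ι ∘ a ]) ⇔ ((K , t ⊨ₑ proj₁ (τ q φ) [ ι ∘ a ]) × (k ⊨ₐ proj₂ (τ q φ) [ a ]))
τ-defines q em k k-field card K ι t rff (ex θ) a =
  mk⇔ (λ sat → to inLringT sat , ConnectiveSemantics.satEx-tautologyEx k _ a θ) (from inLringT ∘ proj₁)
  where
  inLringT : Semantics.satEx K (lift tt) (ι ∘ a) θ ⇔ Semantics.satEx K t (ι ∘ a) (substEx var θ)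
  inLringT = SubstitutionLemma.satEx-substEx K t (ι ∘ a) var (ι ∘ a) (λ _ → CommutativeRing.refl K) θ
τ-defines ∞ em k k-field k-infinite K ι t rff (∀ₐ θ) a =
  Transfer.forall-infinite k K rff k-field em k-infinite a θ
τ-defines (fin m) em k k-field card K ι t rff (∀ₐ θ) a =
  ⇔.trans (Transfer.forall-finite k K rff k-field em card a θ)
          (mk⇔ (λ sat → sat , λ x → ConnectiveSemantics.satEx-tautologyEx k _ (x ∷ᵥ a) θ) proj₁)

proposition5p6 : Proposition5p6
proposition5p6 = record { τ = τ ; vars = τ-vars ; defines = τ-defines }
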